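{- For $\pi\in\Sigma_n$ the following are equivalent: (i) $\pi\in bS_n\cap cS_n$; (ii) $\pi=\mathrm{Id}$, or the cycle decomposition of $\pi$ contains a unique cycle of length $\ge2$, and this cycle is connected and unimodal; (iii) $\pi=\mathrm{Id}$, or the canonical Coxeter expression of $\pi$ is $D(k_1,j_1)\cdots D(k_s,j_s)$ with $k_i+1=j_{i+1}$ for all $1\le i\le s-1$.
   Context: Permutations act on $[n]$; products composed right to left; $\tau_i=(i,i+1)$, $D(k,j)=\tau_k\tau_{k-1}\cdots\tau_j$ for $1\le j\le k\le n-1$. The canonical Coxeter expression of $\pi\ne\mathrm{Id}$ is the unique expression $\pi=D(k_1,j_1)\cdots D(k_s,j_s)$ with $1\le k_1<\dots<k_s\le n-1$, $j_a\le k_a$, whose number of letters equals the Coxeter length of $\pi$. $bS_n$: $\pi=\mathrm{Id}$ or each $\tau_i$ occurs at most once in this expression. $cS_n$: at most one cycle of length $\ge2$ in the disjoint cycle decomposition. A set $\{i,i+1,\dots,j\}$ is a segment; a cycle is connected if its underlying set is a segment. A cycle written $(k_1\,\dots\,k_s)$ with $k_1$ largest is unimodal if $k_1>\dots>k_m<k_{m+1}<\dots<k_s$ for some $m$. -}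

module Defs where

open import Data.Nat using (ℕ; zero; suc; _+_; _∸_; _≤_; _<_; _<?_)
open import Data.Fin using (Fin; toℕ; fromℕ<)
open import Data.Fin.Permutation using (Permutation′; _⟨$⟩ʳ_; transpose)
open import Data.List using (List; []; _∷_; length; applyUpTo; concatMap)
open import Data.List.Relation.Unary.All using (All)
open import Data.List.Relation.Unary.Linked using (Linked)
open import Data.List.Relation.Unary.Unique.Propositional using (Unique)
open import Data.Product using (_×_; _,_; ∃; ∃-syntax; proj₁; proj₂)
open import Data.Sum using (_⊎_)
open import Relation.Nullary using (¬_; yes; no)
open import Relation.Binary.PropositionalEquality using (_≡_; _≢_)
open import Function.Bundles using (_⇔_)

-- Permutations of [n] = {1,…,n}; the point i ∈ [n] is represented by the
-- element of Fin n with toℕ equal to i − 1.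
Perm : ℕ → Set
Perm n = Permutation′ n

IsId : {n : ℕ} → Perm n → Set
IsId {n} π = (x : Fin n) → π ⟨$⟩ʳ x ≡ x

iter : {n : ℕ} → Perm n → ℕ → Fin n → Fin n
iter π zero    x = x
iter π (suc m) x = π ⟨$⟩ʳ (iter π m x)

-- τ_i = (i, i+1) on [n], i.e. swaps the Fin-elements with toℕ = i−1 and i.
-- (Only meaningful for 1 ≤ i ≤ n−1; otherwise a junk value.)
τ : (n : ℕ) → ℕ → Fin n → Fin n
τ n i x with i ∸ 1 <? n | i <? n
... | yes p | yes q = transpose (fromℕ< p) (fromℕ< q) ⟨$⟩ʳ x
... | _     | _     = x

ValidLetter : ℕ → ℕ → Set
ValidLetter n i = (1 ≤ i) × (suc i ≤ n)

-- a word i₁ i₂ … i_r denotes τ_{i₁} τ_{i₂} ⋯ τ_{i_r} (composed right to left)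
evalW : (n : ℕ) → List ℕ → Fin n → Fin n
evalW n []      x = x
evalW n (i ∷ w) x = τ n i (evalW n w x)

Represents : (n : ℕ) → List ℕ → Perm n → Set
Represents n w π = All (ValidLetter n) w × ((x : Fin n) → evalW n w x ≡ π ⟨$⟩ʳ x)

-- D(k,j) = τ_k τ_{k-1} ⋯ τ_j as a word
DW : ℕ → ℕ → List ℕ
DW k j = applyUpTo (λ t → k ∸ t) (suc (k ∸ j))

-- expression D(k₁,j₁)⋯D(k_s,j_s) as list of pairs (k_a , j_a)
Expr : Set
Expr = List (ℕ × ℕ)

wordOf : Expr → List ℕ
wordOf E = concatMap (λ p → DW (proj₁ p) (proj₂ p)) E

BlockOK : ℕ → ℕ × ℕ → Set
BlockOK n (k , j) = (1 ≤ j) × (j ≤ k) × (suc k ≤ n)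

WellFormedExpr : ℕ → Expr → Set
WellFormedExpr n E = All (BlockOK n) E × Linked (λ p q → proj₁ p < proj₁ q) E

-- E is the canonical Coxeter expression of π: of the required shape,
-- represents π, and its number of letters is the Coxeter length of π
-- (no word in the generators representing π is shorter).
IsCanonical : (n : ℕ) → Perm n → Expr → Set
IsCanonical n π E =
  WellFormedExpr n E × Represents n (wordOf E) π ×
  ((w : List ℕ) → Represents n w π → length (wordOf E) ≤ length w)

bS : (n : ℕ) → Perm n → Set
bS n π = IsId π ⊎ (∃[ E ] (IsCanonical n π E × Unique (wordOf E)))

SameCycle : {n : ℕ} → Perm n → Fin n → Fin n → Set
SameCycle π x y = ∃[ m ] (iter π m x ≡ y)

-- cS_n: at most one cycle of length ≥ 2, i.e. any two non-fixed points
-- lie in the same cycle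
cS : (n : ℕ) → Perm n → Set
cS n π = (x y : Fin n) → π ⟨$⟩ʳ x ≢ x → π ⟨$⟩ʳ y ≢ y → SameCycle π x y

-- the cycle through x₀ is connected: its underlying set is a segment
ConnectedCycle : {n : ℕ} → Perm n → Fin n → Set
ConnectedCycle {n} π x₀ =
  ∃[ a ] ∃[ b ] ((y : Fin n) → SameCycle π x₀ y ⇔ ((a ≤ toℕ y) × (toℕ y ≤ b)))

CycleLength : {n : ℕ} → Perm n → Fin n → ℕ → Set
CycleLength π k s =
  (0 < s) × (iter π s k ≡ k) × ((t : ℕ) → 0 < t → t < s → iter π t k ≢ k)

-- the cycle through x₀, written (k₁ … k_s) with k₁ = k its largest element
-- (so k_a = π^{a-1} k), satisfies k₁ > ⋯ > k_m < k_{m+1} < ⋯ < k_s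
UnimodalCycle : {n : ℕ} → Perm n → Fin n → Set
UnimodalCycle {n} π x₀ =
  ∃[ k ] ∃[ s ]
    ( SameCycle π x₀ k
    × ((y : Fin n) → SameCycle π x₀ y → toℕ y ≤ toℕ k)
    × CycleLength π k s
    × ∃[ m ] ( (1 ≤ m) × (m ≤ s)
             × ((t : ℕ) → suc t < m → toℕ (iter π (suc t) k) < toℕ (iter π t k))
             × ((t : ℕ) → m ≤ suc t → suc t < s → toℕ (iter π t k) < toℕ (iter π (suc t) k))))

CondII : (n : ℕ) → Perm n → Set
CondII n π =
  IsId π ⊎
  (∃[ x₀ ] ( (π ⟨$⟩ʳ x₀ ≢ x₀)
           × ((y : Fin n) → π ⟨$⟩ʳ y ≢ y → SameCycle π x₀ y)
           × ConnectedCycle π x₀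
           × UnimodalCycle π x₀))

CondIII : (n : ℕ) → Perm n → Set
CondIII n π =
  IsId π ⊎
  (∃[ E ] (IsCanonical n π E × Linked (λ p q → suc (proj₁ p) ≡ proj₂ q) E))

module Submission where

-- A block D(k,j) acts on positions 0,1,… (position i−1 standing for the point i) as the
-- rotation j−1 ↦ k ↦ k−1 ↦ ⋯ ↦ j−1.  If the blocks of an expression abut (k_i + 1 = j_{i+1}),
-- prepending a block glues its rotation below the cycle of the rest, so the product is a
-- single cycle on the segment [j₁−1, k_s] which falls from the top through the points that
-- are not ascent points, reaches the bottom, and rises back through the ascent points: a
-- connected unimodal cycle.  Such a cycle is determined by its segment [a,b] and its set of
-- ascent points, and each choice is realised by a chain expression with b − a letters; any
-- word representing a cycle on [a,b] contains every letter a+1,…,b, so the chain expression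
-- is the canonical one.  Conversely, if a canonical expression with distinct letters is not
-- a chain, some letter L between its extreme letters is missing, so no position below L is
-- ever moved to a position ≥ L; the bottom and the top of the expression are then moved
-- points in different cycles, against cS.

open import Defs
open import Data.Bool using (Bool; true; false)
open import Data.Empty using (⊥; ⊥-elim)
open import Data.Fin as Fin using (Fin; toℕ; fromℕ<)
open import Data.Fin.Permutation using (_⟨$⟩ʳ_; _⟨$⟩ˡ_; inverseˡ)
import Data.Fin.Permutation.Components as Components
open import Data.Fin.Properties using (toℕ-fromℕ<; fromℕ<-toℕ; toℕ-injective; toℕ<n)
open import Data.List using (List; []; _∷_; _++_; length; applyUpTo)
open import Data.List.Membership.Propositional using (_∈_)
open import Data.List.Membership.Propositional.Properties
  using (∈-∃++; ∈-++⁻; ∈-++⁺ˡ; ∈-++⁺ʳ; ∈-applyUpTo⁺)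
open import Data.List.Properties using (length-++; length-applyUpTo)
open import Data.List.Relation.Unary.All as All using (All; []; _∷_)
import Data.List.Relation.Unary.All.Properties as Allₚ
open import Data.List.Relation.Unary.Any using (here; there)
open import Data.List.Relation.Unary.Linked using (Linked; []; [-]; _∷_)
open import Data.List.Relation.Unary.Unique.Propositional using (Unique)
open import Data.List.Relation.Unary.AllPairs using ([]; _∷_)
import Data.List.Relation.Unary.Unique.Propositional.Properties as Uniqueₚ
open import Data.Nat
open import Data.Nat.Properties
open import Data.List.Membership.DecPropositional _≟_ using (_∈?_)
open import Data.Product
open import Data.Sum as Sum using (_⊎_; inj₁; inj₂; [_,_]′)
open import Function.Base using (_∘_)
open import Function.Bundles using (_⇔_; mk⇔; Equivalence)
open import Relation.Binary.Definitions using (tri<; tri≈; tri>)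
open import Relation.Binary.PropositionalEquality
open import Relation.Nullary using (¬_; yes; no; Dec; does)
open import Relation.Nullary.Decidable using (dec-true; dec-false)

pred<self : ∀ {m n} → m < n → pred n < n
pred<self {n = suc n} _ = n<1+n n

j∸1<k : ∀ {j k} → 1 ≤ j → j ≤ k → j ∸ 1 < k
j∸1<k {suc j} _ j≤k = j≤k

swapℕ : ℕ → ℕ → ℕ → ℕ
swapℕ u v y with y ≟ u
... | yes _ = v
... | no _ with y ≟ v
... | yes _ = u
... | no _ = y

swapℕ-first : ∀ u v y → y ≡ u → swapℕ u v y ≡ v
swapℕ-first u v y y≡u with y ≟ u
... | yes _ = refl
... | no y≢u = ⊥-elim (y≢u y≡u)

swapℕ-second : ∀ u v y → y ≢ u → y ≡ v → swapℕ u v y ≡ u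
swapℕ-second u v y y≢u y≡v with y ≟ u
... | yes y≡u = ⊥-elim (y≢u y≡u)
... | no _ with y ≟ v
... | yes _ = refl
... | no y≢v = ⊥-elim (y≢v y≡v)

swapℕ-other : ∀ u v y → y ≢ u → y ≢ v → swapℕ u v y ≡ y
swapℕ-other u v y y≢u y≢v with y ≟ u
... | yes y≡u = ⊥-elim (y≢u y≡u)
... | no _ with y ≟ v
... | yes y≡v = ⊥-elim (y≢v y≡v)
... | no _ = refl

transpose-first : ∀ {n} (i j k : Fin n) → k ≡ i → Components.transpose i j k ≡ j
transpose-first i j k k≡i rewrite dec-true (k Fin.≟ i) k≡i = refl

transpose-second : ∀ {n} (i j k : Fin n) → k ≢ i → k ≡ j → Components.transpose i j k ≡ i
transpose-second i j k k≢i k≡j rewrite dec-false (k Fin.≟ i) k≢i | dec-true (k Fin.≟ j) k≡j = refl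

transpose-other : ∀ {n} (i j k : Fin n) → k ≢ i → k ≢ j → Components.transpose i j k ≡ k
transpose-other i j k k≢i k≢j rewrite dec-false (k Fin.≟ i) k≢i | dec-false (k Fin.≟ j) k≢j = refl

toℕ-transpose : ∀ {n} (i j k : Fin n) →
                toℕ (Components.transpose i j k) ≡ swapℕ (toℕ i) (toℕ j) (toℕ k)
toℕ-transpose i j k = by-cases (k Fin.≟ i) (k Fin.≟ j)
  where
  by-cases : Dec (k ≡ i) → Dec (k ≡ j) → toℕ (Components.transpose i j k) ≡ swapℕ (toℕ i) (toℕ j) (toℕ k)
  by-cases (yes k≡i) _ = trans (cong toℕ (transpose-first i j k k≡i)) (sym (swapℕ-first _ _ _ (cong toℕ k≡i)))
  by-cases (no k≢i) (yes k≡j) =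
    trans (cong toℕ (transpose-second i j k k≢i k≡j))
          (sym (swapℕ-second _ _ _ (λ e → k≢i (toℕ-injective e)) (cong toℕ k≡j)))
  by-cases (no k≢i) (no k≢j) =
    trans (cong toℕ (transpose-other i j k k≢i k≢j))
          (sym (swapℕ-other _ _ _ (λ e → k≢i (toℕ-injective e)) (λ e → k≢j (toℕ-injective e))))

τℕ : ℕ → ℕ → ℕ
τℕ i = swapℕ (i ∸ 1) i

toℕ-τ : ∀ n i (x : Fin n) → ValidLetter n i → toℕ (τ n i x) ≡ τℕ i (toℕ x)
toℕ-τ n i x (_ , i<n) with i ∸ 1 <? n | i <? n
... | yes p | yes q = trans (toℕ-transpose (fromℕ< p) (fromℕ< q) x)
                            (cong₂ (λ u v → swapℕ u v (toℕ x)) (toℕ-fromℕ< p) (toℕ-fromℕ< q))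
... | no ¬p | _     = ⊥-elim (¬p (≤-<-trans (m∸n≤m i 1) i<n))
... | yes _ | no ¬q = ⊥-elim (¬q i<n)

evalℕ : List ℕ → ℕ → ℕ
evalℕ []      y = y
evalℕ (i ∷ w) y = τℕ i (evalℕ w y)

toℕ-evalW : ∀ n w (x : Fin n) → All (ValidLetter n) w → toℕ (evalW n w x) ≡ evalℕ w (toℕ x)
toℕ-evalW n []      x _        = refl
toℕ-evalW n (i ∷ w) x (v ∷ vs) = trans (toℕ-τ n i (evalW n w x) v) (cong (τℕ i) (toℕ-evalW n w x vs))

evalℕ-++ : ∀ xs ys y → evalℕ (xs ++ ys) y ≡ evalℕ xs (evalℕ ys y)
evalℕ-++ []       ys y = refl
evalℕ-++ (i ∷ xs) ys y = cong (τℕ i) (evalℕ-++ xs ys y)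

-- Blocks as rotations

rotate : ℕ → ℕ → ℕ → ℕ
rotate a c y with y ≟ a
... | yes _ = c
... | no _ with a <? y
... | no _ = y
... | yes _ with y ≤? c
... | yes _ = pred y
... | no _ = y

rotate-bottom : ∀ a c y → y ≡ a → rotate a c y ≡ c
rotate-bottom a c y y≡a with y ≟ a
... | yes _ = refl
... | no y≢a = ⊥-elim (y≢a y≡a)

rotate-interior : ∀ a c y → a < y → y ≤ c → rotate a c y ≡ pred y
rotate-interior a c y a<y y≤c with y ≟ a
... | yes y≡a = ⊥-elim (<-irrefl (sym y≡a) a<y)
... | no _ with a <? y
... | no a≮y = ⊥-elim (a≮y a<y)
... | yes _ with y ≤? c
... | yes _ = refl
... | no y≰c = ⊥-elim (y≰c y≤c)

rotate-outside : ∀ a c y → y ≢ a → y < a ⊎ c < y → rotate a c y ≡ y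
rotate-outside a c y y≢a out with y ≟ a
... | yes y≡a = ⊥-elim (y≢a y≡a)
... | no _ with a <? y
... | no _ = refl
... | yes a<y with y ≤? c
... | yes y≤c = ⊥-elim ([ (λ y<a → <-asym y<a a<y) , (λ c<y → <-irrefl refl (<-≤-trans c<y y≤c)) ]′ out)
... | no _ = refl

rotate-trivial : ∀ a y → rotate a a y ≡ y
rotate-trivial a y with <-cmp y a
... | tri< y<a _ _ = rotate-outside a a y (<⇒≢ y<a) (inj₁ y<a)
... | tri≈ _ y≡a _ = trans (rotate-bottom a a y y≡a) (sym y≡a)
... | tri> _ _ a<y = rotate-outside a a y (>⇒≢ a<y) (inj₂ a<y)

τℕ-rotate : ∀ a c y → a ≤ c → τℕ (suc c) (rotate a c y) ≡ rotate a (suc c) y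
τℕ-rotate a c y a≤c with <-cmp y a
... | tri< y<a _ _
  rewrite rotate-outside a c y (<⇒≢ y<a) (inj₁ y<a) | rotate-outside a (suc c) y (<⇒≢ y<a) (inj₁ y<a)
  = swapℕ-other c (suc c) y (<⇒≢ (<-≤-trans y<a a≤c)) (<⇒≢ (<-≤-trans y<a (m≤n⇒m≤1+n a≤c)))
... | tri≈ _ y≡a _
  rewrite rotate-bottom a c y y≡a | rotate-bottom a (suc c) y y≡a
  = swapℕ-first c (suc c) c refl
... | tri> _ _ a<y with <-cmp y (suc c)
... | tri< y<1+c _ _
  rewrite rotate-interior a c y a<y (s≤s⁻¹ y<1+c) | rotate-interior a (suc c) y a<y (<⇒≤ y<1+c)
  = swapℕ-other c (suc c) (pred y) (<⇒≢ py<c) (<⇒≢ (m<n⇒m<1+n py<c))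
  where
  py<c : pred y < c
  py<c = <-≤-trans (pred<self a<y) (s≤s⁻¹ y<1+c)
... | tri≈ _ refl _
  rewrite rotate-outside a c (suc c) (>⇒≢ a<y) (inj₂ (n<1+n c)) | rotate-interior a (suc c) (suc c) a<y ≤-refl
  = swapℕ-second c (suc c) (suc c) (>⇒≢ (n<1+n c)) refl
... | tri> _ _ 1+c<y
  rewrite rotate-outside a c y (>⇒≢ a<y) (inj₂ (<-trans (n<1+n c) 1+c<y))
        | rotate-outside a (suc c) y (>⇒≢ a<y) (inj₂ 1+c<y)
  = swapℕ-other c (suc c) y (>⇒≢ (<-trans (n<1+n c) 1+c<y)) (>⇒≢ 1+c<y)

evalℕ-DW : ∀ k j → 1 ≤ j → j ≤ k → ∀ y → evalℕ (DW k j) y ≡ rotate (j ∸ 1) k y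
evalℕ-DW k (suc a) _ j≤k y =
  trans (evalℕ-countdown (suc (k ∸ suc a)) (λ t → k ∸ t) (λ t → cong (_∸ t) k≡) y)
        (cong (λ c → rotate a c y) (sym k≡))
  where
  k≡ : k ≡ a + suc (k ∸ suc a)
  k≡ = trans (sym (m+[n∸m]≡n j≤k)) (sym (+-suc a (k ∸ suc a)))
  evalℕ-countdown : ∀ d (f : ℕ → ℕ) → (∀ t → f t ≡ a + d ∸ t) → ∀ y →
                    evalℕ (applyUpTo f d) y ≡ rotate a (a + d) y
  evalℕ-countdown zero f _ y = sym (trans (cong (λ c → rotate a c y) (+-identityʳ a)) (rotate-trivial a y))
  evalℕ-countdown (suc d) f f≡ y = begin
    τℕ (f 0) (evalℕ (applyUpTo (f ∘ suc) d) y)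
      ≡⟨ cong₂ τℕ (trans (f≡ 0) (+-suc a d))
                  (evalℕ-countdown d (f ∘ suc) (λ t → trans (f≡ (suc t)) (cong (_∸ suc t) (+-suc a d))) y) ⟩
    τℕ (suc (a + d)) (rotate a (a + d) y) ≡⟨ τℕ-rotate a (a + d) y (m≤m+n a d) ⟩
    rotate a (suc (a + d)) y              ≡⟨ cong (λ c → rotate a c y) (sym (+-suc a d)) ⟩
    rotate a (a + suc d) y                ∎
    where open ≡-Reasoning

-- UnimodalOn f a b ascends: f is the identity outside [a,b] and one cycle on [a,b] that,
-- starting from b, falls through the descent points (b and the x ∈ (a,b) with ascends x
-- false), each time to the nearest lower descent point or to a, and from a rises through
-- the ascent points (a and the x ∈ (a,b) with ascends x true), each time to the nearest
-- higher ascent point or to b.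
OnDescent OnAscent OnDescent⁺ OnAscent⁺ : ℕ → ℕ → (ℕ → Bool) → ℕ → Set
OnDescent  a b ascends x = x ≡ b ⊎ (a < x × x < b × ascends x ≡ false)
OnAscent   a b ascends x = x ≡ a ⊎ (a < x × x < b × ascends x ≡ true)
OnDescent⁺ a b ascends x = OnDescent a b ascends x ⊎ x ≡ a
OnAscent⁺  a b ascends x = OnAscent a b ascends x ⊎ x ≡ b

record UnimodalOn (f : ℕ → ℕ) (a b : ℕ) (ascends : ℕ → Bool) : Set where
  field
    a<b             : a < b
    fixes-outside   : ∀ x → x < a ⊎ b < x → f x ≡ x
    descent-falls   : ∀ x → OnDescent a b ascends x → f x < x
    descent-lands   : ∀ x → OnDescent a b ascends x → OnDescent⁺ a b ascends (f x)
    descent-nearest : ∀ x → OnDescent a b ascends x →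
                      ∀ y → f x < y → y < x → ¬ OnDescent⁺ a b ascends y
    ascent-rises    : ∀ x → OnAscent a b ascends x → x < f x
    ascent-lands    : ∀ x → OnAscent a b ascends x → OnAscent⁺ a b ascends (f x)
    ascent-nearest  : ∀ x → OnAscent a b ascends x →
                      ∀ y → x < y → y < f x → ¬ OnAscent⁺ a b ascends y

module _ {a b : ℕ} {ascends : ℕ → Bool} (a<b : a < b) where

  OnDescent-range : ∀ {x} → OnDescent a b ascends x → a < x × x ≤ b
  OnDescent-range (inj₁ refl)           = a<b , ≤-refl
  OnDescent-range (inj₂ (a<x , x<b , _)) = a<x , <⇒≤ x<b

  OnAscent-range : ∀ {x} → OnAscent a b ascends x → a ≤ x × x < b
  OnAscent-range (inj₁ refl)           = ≤-refl , a<b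
  OnAscent-range (inj₂ (a<x , x<b , _)) = <⇒≤ a<x , x<b

  OnDescent⁺-range : ∀ {x} → OnDescent⁺ a b ascends x → a ≤ x × x ≤ b
  OnDescent⁺-range (inj₁ d)    = map₁ <⇒≤ (OnDescent-range d)
  OnDescent⁺-range (inj₂ refl) = ≤-refl , <⇒≤ a<b

  OnAscent⁺-range : ∀ {x} → OnAscent⁺ a b ascends x → a ≤ x × x ≤ b
  OnAscent⁺-range (inj₁ d)    = map₂ <⇒≤ (OnAscent-range d)
  OnAscent⁺-range (inj₂ refl) = <⇒≤ a<b , ≤-refl

  pred-OnDescent⁺ : ∀ {x} → (∀ z → a < z → z < x → ascends z ≡ false) →
                    a < x → x ≤ b → OnDescent⁺ a b ascends (pred x)
  pred-OnDescent⁺ {x} below-descends a<x x≤b with <-cmp a (pred x)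
  ... | tri< a<px _ _ = inj₁ (inj₂ (a<px , <-≤-trans (pred<self a<x) x≤b , below-descends (pred x) a<px (pred<self a<x)))
  ... | tri≈ _ a≡px _ = inj₂ (sym a≡px)
  ... | tri> _ _ px<a = ⊥-elim (<-irrefl refl (<-≤-trans px<a (<⇒≤pred a<x)))

¬pred[n]<m<n : ∀ {m n} → pred n < m → m < n → ⊥
¬pred[n]<m<n {n = suc n} pn<m m<n = <-irrefl refl (<-≤-trans pn<m (s≤s⁻¹ m<n))

rotate-unimodal : ∀ a c → a < c → UnimodalOn (rotate a c) a c (λ _ → false)
rotate-unimodal a c a<c = record
  { a<b             = a<c
  ; fixes-outside   = λ x out → rotate-outside a c x ([ <⇒≢ , (λ c<x → >⇒≢ (<-trans a<c c<x)) ]′ out) out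
  ; descent-falls   = λ x d → subst (_< x) (sym (falls x d)) (pred<self (proj₁ (range d)))
  ; descent-lands   = λ x d → subst (OnDescent⁺ a c _) (sym (falls x d))
                                (uncurry (pred-OnDescent⁺ a<c (λ _ _ _ → refl)) (range d))
  ; descent-nearest = λ x d y fx<y y<x _ → ¬pred[n]<m<n (subst (_< y) (falls x d) fx<y) y<x
  ; ascent-rises    = λ { x (inj₁ refl) → subst (x <_) (sym (rotate-bottom a c x refl)) a<c
                        ; x (inj₂ (_ , _ , ())) }
  ; ascent-lands    = λ { x (inj₁ refl) → inj₂ (rotate-bottom a c x refl)
                        ; x (inj₂ (_ , _ , ())) }
  ; ascent-nearest  = λ { x (inj₁ refl) y x<y _ (inj₁ (inj₁ y≡a)) → <-irrefl (sym y≡a) x<y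
                        ; x (inj₁ refl) y _ _ (inj₁ (inj₂ (_ , _ , ())))
                        ; x (inj₁ refl) y _ y<fx (inj₂ y≡c) → <-irrefl y≡c (subst (y <_) (rotate-bottom a c x refl) y<fx)
                        ; x (inj₂ (_ , _ , ())) }
  }
  where
  range : ∀ {x} → OnDescent a c (λ _ → false) x → a < x × x ≤ c
  range = OnDescent-range a<c

  falls : ∀ x → OnDescent a c (λ _ → false) x → rotate a c x ≡ pred x
  falls x d = uncurry (rotate-interior a c x) (range d)

UnimodalOn-cong : ∀ {f g a b ascends} → (∀ x → f x ≡ g x) →
                  UnimodalOn f a b ascends → UnimodalOn g a b ascends
UnimodalOn-cong {a = a} {b} {ascends} f≗g U = record
  { a<b             = a<b
  ; fixes-outside   = λ x out → trans (sym (f≗g x)) (fixes-outside x out)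
  ; descent-falls   = λ x d → subst (_< x) (f≗g x) (descent-falls x d)
  ; descent-lands   = λ x d → subst (OnDescent⁺ a b ascends) (f≗g x) (descent-lands x d)
  ; descent-nearest = λ x d y gx<y → descent-nearest x d y (subst (_< y) (sym (f≗g x)) gx<y)
  ; ascent-rises    = λ x h → subst (x <_) (f≗g x) (ascent-rises x h)
  ; ascent-lands    = λ x h → subst (OnAscent⁺ a b ascends) (f≗g x) (ascent-lands x h)
  ; ascent-nearest  = λ x h y x<y y<gx → ascent-nearest x h y x<y (subst (y <_) (sym (f≗g x)) y<gx) }
  where open UnimodalOn U

module UnimodalOn-ascends-cong {a b : ℕ} {ascends ascends′ : ℕ → Bool}
                               (agree : ∀ x → a < x → x < b → ascends x ≡ ascends′ x) where

  private
    OnDescent-cong : ∀ {x} → OnDescent a b ascends x → OnDescent a b ascends′ x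
    OnDescent-cong (inj₁ e)               = inj₁ e
    OnDescent-cong (inj₂ (a<x , x<b , u)) = inj₂ (a<x , x<b , trans (sym (agree _ a<x x<b)) u)

    OnDescent-cong⁻ : ∀ {x} → OnDescent a b ascends′ x → OnDescent a b ascends x
    OnDescent-cong⁻ (inj₁ e)               = inj₁ e
    OnDescent-cong⁻ (inj₂ (a<x , x<b , u)) = inj₂ (a<x , x<b , trans (agree _ a<x x<b) u)

    OnAscent-cong : ∀ {x} → OnAscent a b ascends x → OnAscent a b ascends′ x
    OnAscent-cong (inj₁ e)               = inj₁ e
    OnAscent-cong (inj₂ (a<x , x<b , u)) = inj₂ (a<x , x<b , trans (sym (agree _ a<x x<b)) u)

    OnAscent-cong⁻ : ∀ {x} → OnAscent a b ascends′ x → OnAscent a b ascends x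
    OnAscent-cong⁻ (inj₁ e)               = inj₁ e
    OnAscent-cong⁻ (inj₂ (a<x , x<b , u)) = inj₂ (a<x , x<b , trans (agree _ a<x x<b) u)

  UnimodalOn-ascends : ∀ {f} → UnimodalOn f a b ascends → UnimodalOn f a b ascends′
  UnimodalOn-ascends U = record
    { a<b             = a<b
    ; fixes-outside   = fixes-outside
    ; descent-falls   = λ x d → descent-falls x (OnDescent-cong⁻ d)
    ; descent-lands   = λ x d → Sum.map₁ OnDescent-cong (descent-lands x (OnDescent-cong⁻ d))
    ; descent-nearest = λ x d y p q d⁺ → descent-nearest x (OnDescent-cong⁻ d) y p q (Sum.map₁ OnDescent-cong⁻ d⁺)
    ; ascent-rises    = λ x h → ascent-rises x (OnAscent-cong⁻ h)
    ; ascent-lands    = λ x h → Sum.map₁ OnAscent-cong (ascent-lands x (OnAscent-cong⁻ h))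
    ; ascent-nearest  = λ x h y p q h⁺ → ascent-nearest x (OnAscent-cong⁻ h) y p q (Sum.map₁ OnAscent-cong⁻ h⁺) }
    where open UnimodalOn U

ascendsFrom : ℕ → (ℕ → Bool) → ℕ → Bool
ascendsFrom c ascends x with x ≟ c
... | yes _ = true
... | no _ with c <? x
... | yes _ = ascends x
... | no _ = false

ascendsFrom-start : ∀ c ascends → ascendsFrom c ascends c ≡ true
ascendsFrom-start c ascends with c ≟ c
... | yes _ = refl
... | no c≢c = ⊥-elim (c≢c refl)

ascendsFrom-below : ∀ c ascends x → x < c → ascendsFrom c ascends x ≡ false
ascendsFrom-below c ascends x x<c with x ≟ c
... | yes x≡c = ⊥-elim (<-irrefl x≡c x<c)
... | no _ with c <? x
... | yes c<x = ⊥-elim (<-asym x<c c<x)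
... | no _ = refl

ascendsFrom-above : ∀ c ascends x → c < x → ascendsFrom c ascends x ≡ ascends x
ascendsFrom-above c ascends x c<x with x ≟ c
... | yes x≡c = ⊥-elim (<-irrefl (sym x≡c) c<x)
... | no _ with c <? x
... | yes _ = refl
... | no c≮x = ⊥-elim (c≮x c<x)

-- Prepending the rotation rotate a c to a unimodal cycle g on [c,b] gives a unimodal cycle
-- on [a,b] in which c becomes an ascent point and (a,c) consists of descent points.
module Prepend (g : ℕ → ℕ) (a c b : ℕ) (asc : ℕ → Bool) (U : UnimodalOn g c b asc) (a<c : a < c) where
  open UnimodalOn U renaming (a<b to c<b)

  ascends : ℕ → Bool
  ascends = ascendsFrom c asc

  f : ℕ → ℕ
  f x = rotate a c (g x)

  a<b : a < b
  a<b = <-trans a<c c<b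

  private
    descent⇒tail : ∀ {y} → OnDescent a b ascends y → c < y → OnDescent c b asc y
    descent⇒tail (inj₁ e)             _   = inj₁ e
    descent⇒tail (inj₂ (_ , y<b , u)) c<y = inj₂ (c<y , y<b , trans (sym (ascendsFrom-above c asc _ c<y)) u)

    tail⇒descent : ∀ {y} → OnDescent c b asc y → OnDescent a b ascends y
    tail⇒descent (inj₁ e)               = inj₁ e
    tail⇒descent (inj₂ (c<y , y<b , u)) = inj₂ (<-trans a<c c<y , y<b , trans (ascendsFrom-above c asc _ c<y) u)

    ascent⇒tail : ∀ {y} → OnAscent a b ascends y → c < y → OnAscent c b asc y
    ascent⇒tail (inj₁ refl)          c<a = ⊥-elim (<-asym a<c c<a)
    ascent⇒tail (inj₂ (_ , y<b , u)) c<y = inj₂ (c<y , y<b , trans (sym (ascendsFrom-above c asc _ c<y)) u)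

    tail⇒ascent : ∀ {y} → OnAscent c b asc y → c < y → OnAscent a b ascends y
    tail⇒ascent (inj₁ refl)              c<c = ⊥-elim (<-irrefl refl c<c)
    tail⇒ascent (inj₂ (c<y , y<b , u)) _   = inj₂ (<-trans a<c c<y , y<b , trans (ascendsFrom-above c asc _ c<y) u)

    descent⁺⇒tail : ∀ {y} → OnDescent⁺ a b ascends y → c < y → OnDescent⁺ c b asc y
    descent⁺⇒tail (inj₁ d)    c<y = inj₁ (descent⇒tail d c<y)
    descent⁺⇒tail (inj₂ refl) c<a = ⊥-elim (<-asym a<c c<a)

    ascent⁺⇒tail : ∀ {y} → OnAscent⁺ a b ascends y → c < y → OnAscent⁺ c b asc y
    ascent⁺⇒tail (inj₁ h) c<y = inj₁ (ascent⇒tail h c<y)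
    ascent⁺⇒tail (inj₂ e) _   = inj₂ e

    descent-split : ∀ {x} → OnDescent a b ascends x → (a < x × x < c) ⊎ OnDescent c b asc x
    descent-split (inj₁ e) = inj₂ (inj₁ e)
    descent-split {x} (inj₂ (a<x , x<b , u)) with <-cmp x c
    ... | tri< x<c _ _ = inj₁ (a<x , x<c)
    ... | tri≈ _ refl _ with () ← trans (sym (ascendsFrom-start c asc)) u
    ... | tri> _ _ c<x = inj₂ (descent⇒tail (inj₂ (a<x , x<b , u)) c<x)

    ascent-split : ∀ {x} → OnAscent a b ascends x → x ≡ a ⊎ OnAscent c b asc x
    ascent-split (inj₁ e) = inj₁ e
    ascent-split {x} (inj₂ (a<x , x<b , u)) with <-cmp x c
    ... | tri< x<c _ _ with () ← trans (sym (ascendsFrom-below c asc x x<c)) u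
    ... | tri≈ _ x≡c _ = inj₂ (inj₁ x≡c)
    ... | tri> _ _ c<x = inj₂ (ascent⇒tail (inj₂ (a<x , x<b , u)) c<x)

    ¬descent⁺-c : ¬ OnDescent⁺ a b ascends c
    ¬descent⁺-c (inj₁ (inj₁ c≡b))         = <-irrefl c≡b c<b
    ¬descent⁺-c (inj₁ (inj₂ (_ , _ , u))) with () ← trans (sym (ascendsFrom-start c asc)) u
    ¬descent⁺-c (inj₂ c≡a)                = <-irrefl (sym c≡a) a<c

    g-below : ∀ x → x < c → g x ≡ x
    g-below x x<c = fixes-outside x (inj₁ x<c)

    f-above : ∀ x → c < g x → f x ≡ g x
    f-above x c<gx = rotate-outside a c (g x) (>⇒≢ (<-trans a<c c<gx)) (inj₂ c<gx)

    f-below : ∀ x → a < x → x < c → f x ≡ pred x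
    f-below x a<x x<c = trans (cong (rotate a c) (g-below x x<c)) (rotate-interior a c x a<x (<⇒≤ x<c))

    f-onto-c : ∀ x → g x ≡ c → f x ≡ pred c
    f-onto-c x gx≡c = trans (cong (rotate a c) gx≡c) (rotate-interior a c c a<c ≤-refl)

    pred-descent⁺ : ∀ x → a < x → x ≤ c → OnDescent⁺ a b ascends (pred x)
    pred-descent⁺ x a<x x≤c =
      pred-OnDescent⁺ a<b (λ z _ z<x → ascendsFrom-below c asc z (<-≤-trans z<x x≤c)) a<x (≤-trans x≤c (<⇒≤ c<b))

    f-fixes-outside : ∀ x → x < a ⊎ b < x → f x ≡ x
    f-fixes-outside x (inj₁ x<a) =
      trans (cong (rotate a c) (g-below x (<-trans x<a a<c))) (rotate-outside a c x (<⇒≢ x<a) (inj₁ x<a))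
    f-fixes-outside x (inj₂ b<x) =
      trans (cong (rotate a c) (fixes-outside x (inj₂ b<x)))
            (rotate-outside a c x (>⇒≢ (<-trans a<b b<x)) (inj₂ (<-trans c<b b<x)))

  record DescentStep (x : ℕ) : Set where
    field
      falls   : f x < x
      lands   : OnDescent⁺ a b ascends (f x)
      nearest : ∀ y → f x < y → y < x → ¬ OnDescent⁺ a b ascends y

  record AscentStep (x : ℕ) : Set where
    field
      rises   : x < f x
      lands   : OnAscent⁺ a b ascends (f x)
      nearest : ∀ y → x < y → y < f x → ¬ OnAscent⁺ a b ascends y

  descent-step : ∀ x → OnDescent a b ascends x → DescentStep x
  descent-step x d with descent-split d
  ... | inj₁ (a<x , x<c) = record
    { falls   = subst (_< x) (sym (f-below x a<x x<c)) (pred<self a<x)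
    ; lands   = subst (OnDescent⁺ a b ascends) (sym (f-below x a<x x<c)) (pred-descent⁺ x a<x (<⇒≤ x<c))
    ; nearest = λ y fx<y y<x _ → ¬pred[n]<m<n (subst (_< y) (f-below x a<x x<c) fx<y) y<x }
  ... | inj₂ d′ with descent-lands x d′
  ... | inj₂ gx≡c = record
    { falls   = subst (_< x) (sym (f-onto-c x gx≡c)) (<-trans (pred<self a<c) (subst (_< x) gx≡c (descent-falls x d′)))
    ; lands   = subst (OnDescent⁺ a b ascends) (sym (f-onto-c x gx≡c)) (pred-descent⁺ c a<c ≤-refl)
    ; nearest = λ y fx<y → nearest′ y (subst (_< y) (f-onto-c x gx≡c) fx<y) }
    where
    nearest′ : ∀ y → pred c < y → y < x → ¬ OnDescent⁺ a b ascends y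
    nearest′ y pc<y y<x d⁺ with <-cmp c y
    ... | tri< c<y _ _ = descent-nearest x d′ y (subst (_< y) (sym gx≡c) c<y) y<x (descent⁺⇒tail d⁺ c<y)
    ... | tri≈ _ refl _ = ¬descent⁺-c d⁺
    ... | tri> _ _ y<c = ¬pred[n]<m<n pc<y y<c
  ... | inj₁ d″ = record
    { falls   = subst (_< x) (sym (f-above x c<gx)) (descent-falls x d′)
    ; lands   = subst (OnDescent⁺ a b ascends) (sym (f-above x c<gx)) (inj₁ (tail⇒descent d″))
    ; nearest = λ y fx<y y<x d⁺ →
        let gx<y = subst (_< y) (f-above x c<gx) fx<y
        in descent-nearest x d′ y gx<y y<x (descent⁺⇒tail d⁺ (<-trans c<gx gx<y)) }
    where
    c<gx : c < g x
    c<gx = proj₁ (OnDescent-range {ascends = asc} c<b d″)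

  ascent-step : ∀ x → OnAscent a b ascends x → AscentStep x
  ascent-step x h with ascent-split h
  ... | inj₁ refl = record
    { rises   = subst (x <_) (sym fa≡c) a<c
    ; lands   = subst (OnAscent⁺ a b ascends) (sym fa≡c) (inj₁ (inj₂ (a<c , c<b , ascendsFrom-start c asc)))
    ; nearest = λ y a<y y<fa → nearest′ y a<y (subst (y <_) fa≡c y<fa) }
    where
    fa≡c : f x ≡ c
    fa≡c = trans (cong (rotate a c) (g-below x a<c)) (rotate-bottom a c x refl)
    nearest′ : ∀ y → x < y → y < c → ¬ OnAscent⁺ a b ascends y
    nearest′ y a<y y<c (inj₁ (inj₁ y≡a))      = <-irrefl (sym y≡a) a<y
    nearest′ y a<y y<c (inj₁ (inj₂ (_ , _ , u))) with () ← trans (sym (ascendsFrom-below c asc y y<c)) u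
    nearest′ y a<y y<c (inj₂ y≡b)             = <-asym y<c (subst (c <_) (sym y≡b) c<b)
  ... | inj₂ h′ = record
    { rises   = subst (x <_) (sym (f-above x c<gx)) (ascent-rises x h′)
    ; lands   = subst (OnAscent⁺ a b ascends) (sym (f-above x c<gx))
                      (Sum.map₁ (λ h″ → tail⇒ascent h″ c<gx) (ascent-lands x h′))
    ; nearest = λ y x<y y<fx h⁺ →
        ascent-nearest x h′ y x<y (subst (y <_) (f-above x c<gx) y<fx) (ascent⁺⇒tail h⁺ (≤-<-trans c≤x x<y)) }
    where
    c≤x : c ≤ x
    c≤x = proj₁ (OnAscent-range {ascends = asc} c<b h′)
    c<gx : c < g x
    c<gx = ≤-<-trans c≤x (ascent-rises x h′)

  unimodal : UnimodalOn f a b ascends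
  unimodal = record
    { a<b             = a<b
    ; fixes-outside   = f-fixes-outside
    ; descent-falls   = λ x d → DescentStep.falls (descent-step x d)
    ; descent-lands   = λ x d → DescentStep.lands (descent-step x d)
    ; descent-nearest = λ x d → DescentStep.nearest (descent-step x d)
    ; ascent-rises    = λ x h → AscentStep.rises (ascent-step x h)
    ; ascent-lands    = λ x h → AscentStep.lands (ascent-step x h)
    ; ascent-nearest  = λ x h → AscentStep.nearest (ascent-step x h) }

Abutting : ℕ × ℕ → ℕ × ℕ → Set
Abutting p q = suc (proj₁ p) ≡ proj₂ q

lastTop : ℕ → Expr → ℕ
lastTop k []              = k
lastTop _ ((k′ , _) ∷ E) = lastTop k′ E

ascendsOf : ℕ → Expr → ℕ → Bool
ascendsOf _ []              = λ _ → false
ascendsOf k ((k′ , _) ∷ E) = ascendsFrom k (ascendsOf k′ E)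

chain-unimodal : ∀ n k j E → All (BlockOK n) ((k , j) ∷ E) → Linked Abutting ((k , j) ∷ E) →
                 UnimodalOn (evalℕ (wordOf ((k , j) ∷ E))) (j ∸ 1) (lastTop k E) (ascendsOf k E)
chain-unimodal n k j [] ((1≤j , j≤k , _) ∷ []) _ =
  UnimodalOn-cong (λ y → sym (trans (evalℕ-++ (DW k j) [] y) (evalℕ-DW k j 1≤j j≤k y)))
                  (rotate-unimodal (j ∸ 1) k (j∸1<k 1≤j j≤k))
chain-unimodal n k j ((k′ , _) ∷ E) ((1≤j , j≤k , _) ∷ oks) (refl ∷ abut) =
  UnimodalOn-cong (λ y → sym (trans (evalℕ-++ (DW k j) (wordOf ((k′ , suc k) ∷ E)) y)
                                    (evalℕ-DW k j 1≤j j≤k _)))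
                  (Prepend.unimodal _ (j ∸ 1) k (lastTop k′ E) (ascendsOf k′ E)
                                    (chain-unimodal n k′ (suc k) E oks abut) (j∸1<k 1≤j j≤k))

iterℕ : (ℕ → ℕ) → ℕ → ℕ → ℕ
iterℕ f zero    x = x
iterℕ f (suc m) x = f (iterℕ f m x)

iterℕ-+ : ∀ f m k x → iterℕ f (m + k) x ≡ iterℕ f m (iterℕ f k x)
iterℕ-+ f zero    k x = refl
iterℕ-+ f (suc m) k x = cong f (iterℕ-+ f m k x)

iterℕ-shift : ∀ f t x → iterℕ f t (f x) ≡ iterℕ f (suc t) x
iterℕ-shift f t x = trans (sym (iterℕ-+ f t 1 x)) (cong (λ m → iterℕ f m x) (+-comm t 1))

module Dynamics {f : ℕ → ℕ} {a b : ℕ} {ascends : ℕ → Bool} (U : UnimodalOn f a b ascends) where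
  open UnimodalOn U

  descent⊎ascent : ∀ x → a ≤ x → x ≤ b → OnDescent a b ascends x ⊎ OnAscent a b ascends x
  descent⊎ascent x a≤x x≤b with <-cmp x a | <-cmp x b
  ... | tri< x<a _ _ | _            = ⊥-elim (<⇒≱ x<a a≤x)
  ... | tri≈ _ x≡a _ | _            = inj₂ (inj₁ x≡a)
  ... | tri> _ _ _   | tri≈ _ x≡b _ = inj₁ (inj₁ x≡b)
  ... | tri> _ _ _   | tri> _ _ b<x = ⊥-elim (<⇒≱ b<x x≤b)
  ... | tri> _ _ a<x | tri< x<b _ _ = by-value (ascends x) refl
    where
    by-value : ∀ v → ascends x ≡ v → OnDescent a b ascends x ⊎ OnAscent a b ascends x
    by-value true  asc  = inj₂ (inj₂ (a<x , x<b , asc))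
    by-value false desc = inj₁ (inj₂ (a<x , x<b , desc))

  stays-in-segment : ∀ x → a ≤ x → x ≤ b → a ≤ f x × f x ≤ b
  stays-in-segment x a≤x x≤b with descent⊎ascent x a≤x x≤b
  ... | inj₁ d = OnDescent⁺-range {ascends = ascends} a<b (descent-lands x d)
  ... | inj₂ h = OnAscent⁺-range {ascends = ascends} a<b (ascent-lands x h)

  iter-stays-in-segment : ∀ t x → a ≤ x → x ≤ b → a ≤ iterℕ f t x × iterℕ f t x ≤ b
  iter-stays-in-segment zero    x a≤x x≤b = a≤x , x≤b
  iter-stays-in-segment (suc t) x a≤x x≤b = uncurry (stays-in-segment _) (iter-stays-in-segment t x a≤x x≤b)

  moved⇒in-segment : ∀ x → f x ≢ x → a ≤ x × x ≤ b
  moved⇒in-segment x moved with <-cmp x a | <-cmp b x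
  ... | tri< x<a _ _ | _            = ⊥-elim (moved (fixes-outside x (inj₁ x<a)))
  ... | _            | tri< b<x _ _ = ⊥-elim (moved (fixes-outside x (inj₂ b<x)))
  ... | tri≈ _ refl _ | _           = ≤-refl , <⇒≤ a<b
  ... | tri> _ _ a<x | tri≈ _ refl _ = <⇒≤ a<x , ≤-refl
  ... | tri> _ _ a<x | tri> _ _ x<b = <⇒≤ a<x , <⇒≤ x<b

  record Descent (x : ℕ) : Set where
    field
      steps       : ℕ
      hits-bottom : iterℕ f steps x ≡ a
      falling     : ∀ t → t < steps → iterℕ f (suc t) x < iterℕ f t x

  record Ascent (x : ℕ) : Set where
    field
      steps     : ℕ
      steps≥1   : 1 ≤ steps
      hits-top  : iterℕ f steps x ≡ b
      on-ascent : ∀ t → t < steps → OnAscent a b ascends (iterℕ f t x)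
      rising    : ∀ t → t < steps → iterℕ f t x < iterℕ f (suc t) x

  private
    ascent-fuel : ∀ {x fuel} → OnAscent a b ascends x → b ≤ x + suc fuel → b ≤ f x + fuel
    ascent-fuel {x} {fuel} h b≤ =
      ≤-trans b≤ (subst (_≤ f x + fuel) (sym (+-suc x fuel)) (+-monoˡ-≤ fuel (ascent-rises x h)))

  descent : ∀ fuel x → x ≤ fuel → OnDescent a b ascends x → Descent x
  descent fuel x x≤fuel d with descent-lands x d
  ... | inj₂ fx≡a = record
    { steps = 1 ; hits-bottom = fx≡a
    ; falling = λ { zero _ → descent-falls x d ; (suc _) (s≤s ()) } }
  descent zero       x x≤0 d | inj₁ _  = ⊥-elim (n≮0 (<-≤-trans (descent-falls x d) x≤0))
  descent (suc fuel) x x≤fuel d | inj₁ d′ = record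
    { steps       = suc R.steps
    ; hits-bottom = trans (sym (iterℕ-shift f R.steps x)) R.hits-bottom
    ; falling     = λ { zero _ → descent-falls x d
                      ; (suc t) (s≤s t<) → subst₂ _<_ (iterℕ-shift f (suc t) x) (iterℕ-shift f t x) (R.falling t t<) } }
    where
    R : Descent (f x)
    R = descent fuel (f x) (s≤s⁻¹ (≤-trans (descent-falls x d) x≤fuel)) d′
    module R = Descent R

  ascent : ∀ fuel x → b ≤ x + fuel → OnAscent a b ascends x → Ascent x
  ascent fuel x b≤ h with ascent-lands x h
  ... | inj₂ fx≡b = record
    { steps = 1 ; steps≥1 = ≤-refl ; hits-top = fx≡b
    ; on-ascent = λ { zero _ → h ; (suc _) (s≤s ()) }
    ; rising    = λ { zero _ → ascent-rises x h ; (suc _) (s≤s ()) } }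
  ascent zero       x b≤x+0 h | inj₁ _ =
    ⊥-elim (<⇒≱ (proj₂ (OnAscent-range {ascends = ascends} a<b h)) (subst (b ≤_) (+-identityʳ x) b≤x+0))
  ascent (suc fuel) x b≤ h | inj₁ h′ = record
    { steps     = suc R.steps
    ; steps≥1   = s≤s z≤n
    ; hits-top  = trans (sym (iterℕ-shift f R.steps x)) R.hits-top
    ; on-ascent = λ { zero _ → h
                    ; (suc t) (s≤s t<) → subst (OnAscent a b ascends) (iterℕ-shift f t x) (R.on-ascent t t<) }
    ; rising    = λ { zero _ → ascent-rises x h
                    ; (suc t) (s≤s t<) → subst₂ _<_ (iterℕ-shift f t x) (iterℕ-shift f (suc t) x) (R.rising t t<) } }
    where
    R : Ascent (f x)
    R = ascent fuel (f x) (ascent-fuel h b≤) h′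
    module R = Ascent R

  descentFromTop : Descent b
  descentFromTop = descent b b ≤-refl (inj₁ refl)

  ascentFromBottom : Ascent a
  ascentFromBottom = ascent b a (m≤n+m b a) (inj₁ refl)

  descent-visits : ∀ fuel x → x ≤ fuel → OnDescent a b ascends x →
                   ∀ y → OnDescent⁺ a b ascends y → y ≤ x → ∃ λ t → iterℕ f t x ≡ y
  descent-visits fuel x x≤fuel d y d⁺ y≤x with <-cmp y x
  ... | tri≈ _ y≡x _ = 0 , sym y≡x
  ... | tri> _ _ x<y = ⊥-elim (<⇒≱ x<y y≤x)
  ... | tri< y<x _ _ with <-cmp y (f x)
  ...   | tri> _ _ fx<y = ⊥-elim (descent-nearest x d y fx<y y<x d⁺)
  ...   | tri≈ _ y≡fx _ = 1 , sym y≡fx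
  ...   | tri< y<fx _ _ with descent-lands x d | fuel
  ...     | inj₂ fx≡a | _ =
    ⊥-elim (<⇒≱ y<fx (subst (_≤ y) (sym fx≡a) (proj₁ (OnDescent⁺-range {ascends = ascends} a<b d⁺))))
  ...     | inj₁ _  | zero = ⊥-elim (n≮0 (<-≤-trans y<x x≤fuel))
  ...     | inj₁ d′ | suc fuel′ =
    let (t , fᵗfx≡y) = descent-visits fuel′ (f x) (s≤s⁻¹ (≤-trans (descent-falls x d) x≤fuel)) d′
                                      y d⁺ (<⇒≤ y<fx)
    in suc t , trans (sym (iterℕ-shift f t x)) fᵗfx≡y

  ascent-visits : ∀ fuel x → b ≤ x + fuel → OnAscent a b ascends x →
                  ∀ y → OnAscent⁺ a b ascends y → x ≤ y → ∃ λ t → iterℕ f t x ≡ y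
  ascent-visits fuel x b≤ h y h⁺ x≤y with <-cmp x y
  ... | tri≈ _ x≡y _ = 0 , x≡y
  ... | tri> _ _ y<x = ⊥-elim (<⇒≱ y<x x≤y)
  ... | tri< x<y _ _ with <-cmp (f x) y
  ...   | tri> _ _ y<fx = ⊥-elim (ascent-nearest x h y x<y y<fx h⁺)
  ...   | tri≈ _ fx≡y _ = 1 , fx≡y
  ...   | tri< fx<y _ _ with ascent-lands x h | fuel
  ...     | inj₂ fx≡b | _ =
    ⊥-elim (<⇒≱ fx<y (subst (y ≤_) (sym fx≡b) (proj₂ (OnAscent⁺-range {ascends = ascends} a<b h⁺))))
  ...     | inj₁ _  | zero =
    ⊥-elim (<⇒≱ x<y (≤-trans (proj₂ (OnAscent⁺-range {ascends = ascends} a<b h⁺))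
                            (subst (b ≤_) (+-identityʳ x) b≤)))
  ...     | inj₁ h′ | suc fuel′ =
    let (t , fᵗfx≡y) = ascent-visits fuel′ (f x) (ascent-fuel h b≤) h′ y h⁺ (<⇒≤ fx<y)
    in suc t , trans (sym (iterℕ-shift f t x)) fᵗfx≡y

  reachable-from-top : ∀ y → a ≤ y → y ≤ b → ∃ λ t → iterℕ f t b ≡ y
  reachable-from-top y a≤y y≤b with descent⊎ascent y a≤y y≤b
  ... | inj₁ d = descent-visits b b ≤-refl (inj₁ refl) y (inj₁ d) y≤b
  ... | inj₂ h =
    let (t , fᵗa≡y) = ascent-visits b a (m≤n+m b a) (inj₁ refl) y (inj₁ h) a≤y
    in t + D.steps , trans (iterℕ-+ f t D.steps b) (trans (cong (iterℕ f t) D.hits-bottom) fᵗa≡y)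
    where module D = Descent descentFromTop

  reaches-top : ∀ y → a ≤ y → y ≤ b → ∃ λ t → iterℕ f t y ≡ b
  reaches-top y a≤y y≤b with descent⊎ascent y a≤y y≤b
  ... | inj₂ h = A.steps , A.hits-top
    where module A = Ascent (ascent b y (≤-trans (m≤n+m b a) (+-monoˡ-≤ b a≤y)) h)
  ... | inj₁ d = A.steps + D.steps ,
                 trans (iterℕ-+ f A.steps D.steps y) (trans (cong (iterℕ f A.steps) D.hits-bottom) A.hits-top)
    where
    module A = Ascent ascentFromBottom
    module D = Descent (descent y y ≤-refl d)

iter-+ : ∀ {n} (π : Perm n) m k x → iter π (m + k) x ≡ iter π m (iter π k x)
iter-+ π zero    k x = refl
iter-+ π (suc m) k x = cong (π ⟨$⟩ʳ_) (iter-+ π m k x)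

Models : ∀ {n} → Perm n → (ℕ → ℕ) → Set
Models {n} π g = ∀ (x : Fin n) → toℕ (π ⟨$⟩ʳ x) ≡ g (toℕ x)

toℕ-iter : ∀ {n} {π : Perm n} {g} → Models π g → ∀ t x → toℕ (iter π t x) ≡ iterℕ g t (toℕ x)
toℕ-iter model zero    x = refl
toℕ-iter {g = g} model (suc t) x = trans (model _) (cong g (toℕ-iter model t x))

module OnPerm {n} (π : Perm n) {g : ℕ → ℕ} (model : Models π g)
              {a b : ℕ} {ascends : ℕ → Bool} (U : UnimodalOn g a b ascends) (b<n : b < n) where
  open UnimodalOn U
  open Dynamics U

  top : Fin n
  top = fromℕ< b<n

  toℕ-iter-top : ∀ t → toℕ (iter π t top) ≡ iterℕ g t b
  toℕ-iter-top t = trans (toℕ-iter model t top) (cong (iterℕ g t) (toℕ-fromℕ< b<n))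

  in-segment⇒same-cycle : ∀ y → a ≤ toℕ y → toℕ y ≤ b → SameCycle π top y
  in-segment⇒same-cycle y a≤y y≤b =
    let (t , gᵗb≡y) = reachable-from-top (toℕ y) a≤y y≤b in t , toℕ-injective (trans (toℕ-iter-top t) gᵗb≡y)

  same-cycle⇒in-segment : ∀ y → SameCycle π top y → a ≤ toℕ y × toℕ y ≤ b
  same-cycle⇒in-segment y (t , πᵗtop≡y) =
    subst (λ z → a ≤ z × z ≤ b) (trans (sym (toℕ-iter-top t)) (cong toℕ πᵗtop≡y))
          (iter-stays-in-segment t b (<⇒≤ a<b) ≤-refl)

  moved-in-segment : ∀ y → π ⟨$⟩ʳ y ≢ y → a ≤ toℕ y × toℕ y ≤ b
  moved-in-segment y moved = moved⇒in-segment (toℕ y) (λ e → moved (toℕ-injective (trans (model y) e)))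

  moved⇒same-cycle : ∀ y → π ⟨$⟩ʳ y ≢ y → SameCycle π top y
  moved⇒same-cycle y moved = uncurry (in-segment⇒same-cycle y) (moved-in-segment y moved)

  top-moved : π ⟨$⟩ʳ top ≢ top
  top-moved e = <-irrefl (cong toℕ e)
    (subst₂ _<_ (sym (toℕ-iter-top 1)) (sym (toℕ-fromℕ< b<n)) (descent-falls b (inj₁ refl)))

  private
    module D = Descent descentFromTop
    module A = Ascent ascentFromBottom

  period : ℕ
  period = A.steps + D.steps

  returns : iterℕ g period b ≡ b
  returns = trans (iterℕ-+ g A.steps D.steps b) (trans (cong (iterℕ g A.steps) D.hits-bottom) A.hits-top)

  after-descent : ∀ t → D.steps ≤ t → iterℕ g t b ≡ iterℕ g (t ∸ D.steps) a
  after-descent t d≤t =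
    trans (cong (λ m → iterℕ g m b) (sym (m∸n+n≡m d≤t)))
          (trans (iterℕ-+ g (t ∸ D.steps) D.steps b) (cong (iterℕ g (t ∸ D.steps)) D.hits-bottom))

  ascent-index : ∀ {t} → D.steps ≤ t → t < period → t ∸ D.steps < A.steps
  ascent-index {t} d≤t t<p = subst (t ∸ D.steps <_) (m+n∸n≡m A.steps D.steps) (∸-monoˡ-< t<p d≤t)

  no-earlier-return : ∀ t → 0 < t → t < period → iterℕ g t b ≢ b
  no-earlier-return (suc t) _ t<p gᵗb≡b with suc t ≤? D.steps
  ... | yes t<d = <-irrefl gᵗb≡b (<-≤-trans (D.falling t t<d) (proj₂ (iter-stays-in-segment t b (<⇒≤ a<b) ≤-refl)))
  ... | no t≮d  = <-irrefl (trans (sym (after-descent (suc t) d≤t)) gᵗb≡b)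
                           (proj₂ (OnAscent-range {ascends = ascends} a<b (A.on-ascent _ (ascent-index d≤t t<p))))
    where
    d≤t : D.steps ≤ suc t
    d≤t = <⇒≤ (≰⇒> t≮d)

  rising-after-descent : ∀ t → D.steps ≤ t → suc t < period → iterℕ g t b < iterℕ g (suc t) b
  rising-after-descent t d≤t t+1<p =
    subst₂ _<_ (sym (after-descent t d≤t))
               (sym (trans (after-descent (suc t) (m≤n⇒m≤1+n d≤t)) (cong (λ m → iterℕ g m a) (+-∸-assoc 1 d≤t))))
           (A.rising (t ∸ D.steps) (ascent-index d≤t (<-trans (n<1+n t) t+1<p)))

  unimodal : UnimodalCycle π top
  unimodal =
    top , period , (0 , refl) ,
    (λ y same → subst (toℕ y ≤_) (sym (toℕ-fromℕ< b<n)) (proj₂ (same-cycle⇒in-segment y same))) ,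
    ( ≤-trans A.steps≥1 (m≤m+n A.steps D.steps)
    , toℕ-injective (trans (toℕ-iter-top period) (trans returns (sym (toℕ-fromℕ< b<n))))
    , λ t t>0 t<p e → no-earlier-return t t>0 t<p
                        (trans (sym (toℕ-iter-top t)) (trans (cong toℕ e) (toℕ-fromℕ< b<n)))) ,
    suc D.steps , s≤s z≤n , +-monoˡ-≤ D.steps A.steps≥1 ,
    (λ t t+1<m → subst₂ _<_ (sym (toℕ-iter-top (suc t))) (sym (toℕ-iter-top t)) (D.falling t (s≤s⁻¹ t+1<m))) ,
    (λ t m≤t+1 t+1<p → subst₂ _<_ (sym (toℕ-iter-top t)) (sym (toℕ-iter-top (suc t)))
                                   (rising-after-descent t (s≤s⁻¹ m≤t+1) t+1<p))

  condII : CondII n π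
  condII = inj₂ (top , top-moved , moved⇒same-cycle ,
                 (a , b , λ y → mk⇔ (same-cycle⇒in-segment y) (uncurry (in-segment⇒same-cycle y))) ,
                 unimodal)

  in-segment⇒reaches-top : ∀ x → a ≤ toℕ x → toℕ x ≤ b → SameCycle π x top
  in-segment⇒reaches-top x a≤x x≤b =
    let (s , gˢx≡b) = reaches-top (toℕ x) a≤x x≤b
    in s , toℕ-injective (trans (toℕ-iter model s x) (trans gˢx≡b (sym (toℕ-fromℕ< b<n))))

  cS-holds : cS n π
  cS-holds x y x-moved y-moved =
    let (s , πˢx≡top) = uncurry (in-segment⇒reaches-top x) (moved-in-segment x x-moved)
        (t , πᵗtop≡y) = moved⇒same-cycle y y-moved
    in t + s , trans (iter-+ π t s x) (trans (cong (iter π t) πˢx≡top) πᵗtop≡y)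

DW-letters : ∀ k j → j ≤ k → All (λ ℓ → j ≤ ℓ × ℓ ≤ k) (DW k j)
DW-letters k j j≤k = Allₚ.applyUpTo⁺₁ (k ∸_) (suc (k ∸ j)) (λ {i} i≤ → j≤k∸i i i≤ , m∸n≤m k i)
  where
  j≤k∸i : ∀ i → i < suc (k ∸ j) → j ≤ k ∸ i
  j≤k∸i i i≤ = subst (_≤ k ∸ i) (m∸[m∸n]≡n j≤k) (∸-monoʳ-≤ k (s≤s⁻¹ i≤))

∈-DW : ∀ k j ℓ → j ≤ ℓ → ℓ ≤ k → ℓ ∈ DW k j
∈-DW k j ℓ j≤ℓ ℓ≤k = subst (_∈ DW k j) (m∸[m∸n]≡n ℓ≤k) (∈-applyUpTo⁺ (k ∸_) (s≤s (∸-monoʳ-≤ k j≤ℓ)))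

Unique-DW : ∀ k j → Unique (DW k j)
Unique-DW k j = Uniqueₚ.applyUpTo⁺₁ (k ∸_) (suc (k ∸ j))
  (λ i<i′ i′≤ e → <-irrefl (sym e) (∸-monoʳ-< i<i′ (≤-trans (s≤s⁻¹ i′≤) (m∸n≤m k j))))

length-DW : ∀ k j → length (DW k j) ≡ suc (k ∸ j)
length-DW k j = length-applyUpTo (k ∸_) (suc (k ∸ j))

wordOf-valid : ∀ n E → All (BlockOK n) E → All (ValidLetter n) (wordOf E)
wordOf-valid n []            []                       = []
wordOf-valid n ((k , j) ∷ E) ((1≤j , j≤k , k<n) ∷ oks) =
  Allₚ.++⁺ (All.map (λ (j≤ℓ , ℓ≤k) → ≤-trans 1≤j j≤ℓ , ≤-<-trans ℓ≤k k<n) (DW-letters k j j≤k))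
           (wordOf-valid n E oks)

lastTop<n : ∀ n k j E → All (BlockOK n) ((k , j) ∷ E) → lastTop k E < n
lastTop<n n k j []              ((_ , _ , k<n) ∷ _) = k<n
lastTop<n n k j ((k′ , j′) ∷ E) (_ ∷ oks)           = lastTop<n n k′ j′ E oks

TopsIncrease : ℕ × ℕ → ℕ × ℕ → Set
TopsIncrease p q = proj₁ p < proj₁ q

lastTop-≥ : ∀ k j E → Linked TopsIncrease ((k , j) ∷ E) → k ≤ lastTop k E
lastTop-≥ k j []              _            = ≤-refl
lastTop-≥ k j ((k′ , j′) ∷ E) (k<k′ ∷ inc) = ≤-trans (<⇒≤ k<k′) (lastTop-≥ k′ j′ E inc)

abutting⇒increasing : ∀ {E} → Linked Abutting E → All (λ p → proj₂ p ≤ proj₁ p) E → Linked TopsIncrease E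
abutting⇒increasing []           _                 = []
abutting⇒increasing [-]          _                 = [-]
abutting⇒increasing (k+1≡j ∷ abut) (_ ∷ j≤k ∷ j≤ks) =
  subst (_≤ _) (sym k+1≡j) j≤k ∷ abutting⇒increasing abut (j≤k ∷ j≤ks)

chain-letters≥ : ∀ n k j E → All (BlockOK n) ((k , j) ∷ E) → Linked Abutting ((k , j) ∷ E) →
                 All (j ≤_) (wordOf ((k , j) ∷ E))
chain-letters≥ n k j [] ((_ , j≤k , _) ∷ []) _ = Allₚ.++⁺ (All.map proj₁ (DW-letters k j j≤k)) []
chain-letters≥ n k j ((k′ , _) ∷ E) ((_ , j≤k , _) ∷ oks) (refl ∷ abut) =
  Allₚ.++⁺ (All.map proj₁ (DW-letters k j j≤k))
           (All.map (≤-trans (m≤n⇒m≤1+n j≤k)) (chain-letters≥ n k′ (suc k) E oks abut))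

chain-unique : ∀ n k j E → All (BlockOK n) ((k , j) ∷ E) → Linked Abutting ((k , j) ∷ E) →
               Unique (wordOf ((k , j) ∷ E))
chain-unique n k j [] ((_ , j≤k , _) ∷ []) _ = Uniqueₚ.++⁺ (Unique-DW k j) [] (λ { (_ , ()) })
chain-unique n k j ((k′ , _) ∷ E) ((_ , j≤k , _) ∷ oks) (refl ∷ abut) =
  Uniqueₚ.++⁺ (Unique-DW k j) (chain-unique n k′ (suc k) E oks abut)
    (λ (ℓ∈block , ℓ∈rest) → <⇒≱ (s≤s (proj₂ (All.lookup (DW-letters k j j≤k) ℓ∈block)))
                                 (All.lookup (chain-letters≥ n k′ (suc k) E oks abut) ℓ∈rest))

chain-length : ∀ n k j E → All (BlockOK n) ((k , j) ∷ E) → Linked Abutting ((k , j) ∷ E) →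
               length (wordOf ((k , j) ∷ E)) + (j ∸ 1) ≡ lastTop k E
chain-length n k (suc i) E ((_ , j≤k , _) ∷ oks) abut = begin
  length (DW k (suc i) ++ wordOf E) + i   ≡⟨ cong (_+ i) (length-++ (DW k (suc i))) ⟩
  length (DW k (suc i)) + L + i           ≡⟨ cong (λ m → m + L + i) (length-DW k (suc i)) ⟩
  suc (k ∸ suc i) + L + i                 ≡⟨ +-assoc (suc (k ∸ suc i)) L i ⟩
  suc (k ∸ suc i) + (L + i)               ≡⟨ cong (suc (k ∸ suc i) +_) (+-comm L i) ⟩
  suc (k ∸ suc i) + (i + L)               ≡⟨ sym (+-assoc (suc (k ∸ suc i)) i L) ⟩
  suc (k ∸ suc i) + i + L                 ≡⟨ cong (_+ L) block-length ⟩
  k + L                                   ≡⟨ rest E oks abut ⟩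
  lastTop k E                             ∎
  where
  open ≡-Reasoning
  L : ℕ
  L = length (wordOf E)
  block-length : suc (k ∸ suc i) + i ≡ k
  block-length = trans (sym (+-suc (k ∸ suc i) i)) (m∸n+n≡m j≤k)
  rest : ∀ E → All (BlockOK n) E → Linked Abutting ((k , suc i) ∷ E) → k + length (wordOf E) ≡ lastTop k E
  rest []              _   _             = +-identityʳ k
  rest ((k′ , _) ∷ E′) oks (refl ∷ abut′) =
    trans (+-comm k _) (chain-length n k′ (suc k) E′ oks abut′)

-- (iii) ⇒ (i) and (iii) ⇒ (ii)

represents⇒models : ∀ {n} w (π : Perm n) → Represents n w π → Models π (evalℕ w)
represents⇒models {n} w π (valid , eval≗π) x = trans (cong toℕ (sym (eval≗π x))) (toℕ-evalW n w x valid)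

module FromChain {n} (π : Perm n) (k j : ℕ) (E : Expr) (wf : WellFormedExpr n ((k , j) ∷ E))
                 (rep : Represents n (wordOf ((k , j) ∷ E)) π) (abut : Linked Abutting ((k , j) ∷ E)) where
  open OnPerm π (represents⇒models _ π rep) (chain-unimodal n k j E (proj₁ wf) abut) (lastTop<n n k j E (proj₁ wf))
    public

empty-represents-Id : ∀ {n} (π : Perm n) → Represents n [] π → IsId π
empty-represents-Id π (_ , eval≗π) x = sym (eval≗π x)

III⇒II : ∀ n π → CondIII n π → CondII n π
III⇒II n π (inj₁ id)                                     = inj₁ id
III⇒II n π (inj₂ ([] , (_ , rep , _) , _))               = inj₁ (empty-represents-Id π rep)
III⇒II n π (inj₂ (((k , j) ∷ E) , (wf , rep , _) , abut)) = FromChain.condII π k j E wf rep abut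

III⇒I : ∀ n π → CondIII n π → bS n π × cS n π
III⇒I n π (inj₁ id) = inj₁ id , λ x _ x-moved _ → ⊥-elim (x-moved (id x))
III⇒I n π (inj₂ ([] , (_ , rep , _) , _)) =
  inj₁ (empty-represents-Id π rep) , λ x _ x-moved _ → ⊥-elim (x-moved (empty-represents-Id π rep x))
III⇒I n π (inj₂ (((k , j) ∷ E) , canonical@(wf , rep , _) , abut)) =
  inj₂ (((k , j) ∷ E) , canonical , chain-unique n k j E (proj₁ wf) abut) , FromChain.cS-holds π k j E wf rep abut

-- (i) ⇒ (iii)

Unique-++-disjoint : ∀ (xs ys : List ℕ) {v} → Unique (xs ++ ys) → v ∈ xs → v ∈ ys → ⊥
Unique-++-disjoint (x ∷ xs) ys (x∉ ∷ _) (here refl) v∈ys = All.lookup (Allₚ.++⁻ʳ xs x∉) v∈ys refl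
Unique-++-disjoint (x ∷ xs) ys (_ ∷ u)  (there v∈xs) v∈ys = Unique-++-disjoint xs ys u v∈xs v∈ys

Unique-++⁻ʳ : ∀ (xs ys : List ℕ) → Unique (xs ++ ys) → Unique ys
Unique-++⁻ʳ []       ys u       = u
Unique-++⁻ʳ (x ∷ xs) ys (_ ∷ u) = Unique-++⁻ʳ xs ys u

-- if τ_k occurred in both blocks, the letters would not be distinct
unique⇒separated : ∀ k j k′ j′ rest → j ≤ k → k < k′ → j′ ≤ k′ →
                   Unique (DW k j ++ (DW k′ j′ ++ rest)) → k < j′
unique⇒separated k j k′ j′ rest j≤k k<k′ j′≤k′ u with k <? j′
... | yes k<j′ = k<j′
... | no k≮j′  = ⊥-elim (Unique-++-disjoint (DW k j) _ u (∈-DW k j k j≤k ≤-refl)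
                                                           (∈-++⁺ˡ (∈-DW k′ j′ k (≮⇒≥ k≮j′) (<⇒≤ k<k′))))

unique⇒letters≥ : ∀ n k j E → All (BlockOK n) ((k , j) ∷ E) → Linked TopsIncrease ((k , j) ∷ E) →
                  Unique (wordOf ((k , j) ∷ E)) → All (j ≤_) (wordOf ((k , j) ∷ E))
unique⇒letters≥ n k j [] ((_ , j≤k , _) ∷ []) _ _ = Allₚ.++⁺ (All.map proj₁ (DW-letters k j j≤k)) []
unique⇒letters≥ n k j ((k′ , j′) ∷ E) ((_ , j≤k , _) ∷ oks@((_ , j′≤k′ , _) ∷ _)) (k<k′ ∷ inc) u =
  Allₚ.++⁺ (All.map proj₁ (DW-letters k j j≤k))
           (All.map (≤-trans (≤-trans j≤k (<⇒≤ k<j′)))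
                    (unique⇒letters≥ n k′ j′ E oks inc (Unique-++⁻ʳ (DW k j) _ u)))
  where
  k<j′ : k < j′
  k<j′ = unique⇒separated k j k′ j′ (wordOf E) j≤k k<k′ j′≤k′ u

MissingLetter : ℕ → ℕ → Expr → Set
MissingLetter k j E = ∃ λ L → j ∸ 1 < L × L ≤ lastTop k E × All (_≢ L) (wordOf ((k , j) ∷ E))

abutting⊎missing-letter : ∀ n k j E → All (BlockOK n) ((k , j) ∷ E) → Linked TopsIncrease ((k , j) ∷ E) →
                          Unique (wordOf ((k , j) ∷ E)) → Linked Abutting ((k , j) ∷ E) ⊎ MissingLetter k j E
abutting⊎missing-letter n k j [] _ _ _ = inj₁ [-]
abutting⊎missing-letter n k j ((k′ , j′) ∷ E) ((_ , j≤k , _) ∷ oks@((_ , j′≤k′ , _) ∷ _)) (k<k′ ∷ inc) u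
  with j′ ≟ suc k
... | no j′≢k+1 =
  inj₂ (suc k , s≤s (≤-trans (m∸n≤m j 1) j≤k) , ≤-trans (<⇒≤ k+1<j′) (≤-trans j′≤k′ (lastTop-≥ k′ j′ E inc)) ,
        Allₚ.++⁺ (All.map (λ (_ , ℓ≤k) → <⇒≢ (s≤s ℓ≤k)) (DW-letters k j j≤k))
                 (All.map (λ j′≤ℓ → >⇒≢ (<-≤-trans k+1<j′ j′≤ℓ))
                          (unique⇒letters≥ n k′ j′ E oks inc (Unique-++⁻ʳ (DW k j) _ u))))
  where
  k+1<j′ : suc k < j′
  k+1<j′ = ≤∧≢⇒< (unique⇒separated k j k′ j′ (wordOf E) j≤k k<k′ j′≤k′ u) (λ e → j′≢k+1 (sym e))
... | yes refl with abutting⊎missing-letter n k′ (suc k) E oks inc (Unique-++⁻ʳ (DW k j) _ u)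
...   | inj₁ abut = inj₁ (refl ∷ abut)
...   | inj₂ (L , k<L , L≤top , L∉) =
  inj₂ (L , ≤-<-trans (≤-trans (m∸n≤m j 1) j≤k) k<L , L≤top ,
        Allₚ.++⁺ (All.map (λ (_ , ℓ≤k) → <⇒≢ (≤-<-trans ℓ≤k k<L)) (DW-letters k j j≤k)) L∉)

τℕ-below : ∀ i L y → i ≢ L → y < L → τℕ i y < L
τℕ-below i L y i≢L y<L with y ≟ i ∸ 1
... | yes refl = i-below i i≢L y<L
  where
  i-below : ∀ i → i ≢ L → i ∸ 1 < L → i < L
  i-below zero    _   0<L   = 0<L
  i-below (suc i) i≢L i<L = ≤∧≢⇒< i<L i≢L
... | no _ with y ≟ i
... | yes refl = ≤-<-trans (m∸n≤m y 1) y<L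
... | no _ = y<L

evalℕ-below : ∀ L w y → All (_≢ L) w → y < L → evalℕ w y < L
evalℕ-below L []      y _          y<L = y<L
evalℕ-below L (i ∷ w) y (i≢L ∷ L∉) y<L = τℕ-below i L (evalℕ w y) i≢L (evalℕ-below L w y L∉ y<L)

iterℕ-below : ∀ (g : ℕ → ℕ) L → (∀ z → z < L → g z < L) → ∀ t z → z < L → iterℕ g t z < L
iterℕ-below g L g-below zero    z z<L = z<L
iterℕ-below g L g-below (suc t) z z<L = g-below _ (iterℕ-below g L g-below t z z<L)

missing-letter⇒¬SameCycle : ∀ {n} (π : Perm n) w L → Represents n w π → All (_≢ L) w →
                            ∀ x y → toℕ x < L → L ≤ toℕ y → ¬ SameCycle π x y
missing-letter⇒¬SameCycle π w L rep L∉ x y x<L L≤y (t , πᵗx≡y) =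
  <⇒≱ (subst (_< L) (trans (sym (toℕ-iter (represents⇒models w π rep) t x)) (cong toℕ πᵗx≡y))
                    (iterℕ-below (evalℕ w) L (λ z → evalℕ-below L w z L∉) t (toℕ x) x<L))
      L≤y

τℕ-fixes : ∀ i y → suc y < i → τℕ i y ≡ y
τℕ-fixes (suc i) y (s≤s y<i) = swapℕ-other i (suc i) y (<⇒≢ y<i) (<⇒≢ (m<n⇒m<1+n y<i))

evalℕ-fixes : ∀ w y → All (λ i → suc y < i) w → evalℕ w y ≡ y
evalℕ-fixes []      y _           = refl
evalℕ-fixes (i ∷ w) y (y+1<i ∷ hs) = trans (cong (τℕ i) (evalℕ-fixes w y hs)) (τℕ-fixes i y y+1<i)

bottom-rises : ∀ n k j E → All (BlockOK n) ((k , j) ∷ E) → Linked TopsIncrease ((k , j) ∷ E) →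
               Unique (wordOf ((k , j) ∷ E)) → evalℕ (wordOf ((k , j) ∷ E)) (j ∸ 1) ≡ k
bottom-rises n k j E oks@((1≤j , j≤k , _) ∷ _) inc u =
  trans (evalℕ-++ (DW k j) (wordOf E) (j ∸ 1))
        (trans (cong (evalℕ (DW k j)) (evalℕ-fixes (wordOf E) (j ∸ 1) (tail-letters> E oks inc u)))
               (trans (evalℕ-DW k j 1≤j j≤k (j ∸ 1)) (rotate-bottom (j ∸ 1) k (j ∸ 1) refl)))
  where
  tail-letters> : ∀ E → All (BlockOK n) ((k , j) ∷ E) → Linked TopsIncrease ((k , j) ∷ E) →
                  Unique (wordOf ((k , j) ∷ E)) → All (λ i → suc (j ∸ 1) < i) (wordOf E)
  tail-letters> []              _ _ _ = []
  tail-letters> ((k′ , j′) ∷ E′) (_ ∷ oks′@((_ , j′≤k′ , _) ∷ _)) (k<k′ ∷ inc′) u′ =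
    All.map (<-≤-trans (≤-<-trans (≤-trans (≤-reflexive (suc-j∸1 1≤j)) j≤k)
                                  (unique⇒separated k j k′ j′ (wordOf E′) j≤k k<k′ j′≤k′ u′)))
            (unique⇒letters≥ n k′ j′ E′ oks′ inc′ (Unique-++⁻ʳ (DW k j) _ u′))
    where
    suc-j∸1 : ∀ {j} → 1 ≤ j → suc (j ∸ 1) ≡ j
    suc-j∸1 {suc _} _ = refl

lastTop-falls : ∀ n k j E → All (BlockOK n) ((k , j) ∷ E) → Linked TopsIncrease ((k , j) ∷ E) →
                evalℕ (wordOf ((k , j) ∷ E)) (lastTop k E) < lastTop k E
lastTop-falls n k j [] ((1≤j , j≤k , _) ∷ []) _ =
  subst (_< k) (sym (trans (evalℕ-++ (DW k j) [] k)
                           (trans (evalℕ-DW k j 1≤j j≤k k) (rotate-interior (j ∸ 1) k k (j∸1<k 1≤j j≤k) ≤-refl))))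
        (pred<self (j∸1<k 1≤j j≤k))
lastTop-falls n k j ((k′ , j′) ∷ E) ((_ , j≤k , _) ∷ oks) (k<k′ ∷ inc) =
  subst (_< top) (sym (evalℕ-++ (DW k j) (wordOf ((k′ , j′) ∷ E)) top))
        (evalℕ-below top (DW k j) _
                     (All.map (λ (_ , ℓ≤k) → <⇒≢ (≤-<-trans ℓ≤k (<-≤-trans k<k′ (lastTop-≥ k′ j′ E inc))))
                              (DW-letters k j j≤k))
                     (lastTop-falls n k′ j′ E oks inc))
  where
  top : ℕ
  top = lastTop k′ E

I⇒III : ∀ n π → bS n π × cS n π → CondIII n π
I⇒III n π (inj₁ id , _) = inj₁ id
I⇒III n π (inj₂ ([] , canonical , _) , _) = inj₂ ([] , canonical , [])
I⇒III n π (inj₂ (((k , j) ∷ E) , canonical@((oks@((1≤j , j≤k , k<n) ∷ _) , inc) , rep , _) , u) , cs)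
  with abutting⊎missing-letter n k j E oks inc u
... | inj₁ abut = inj₂ (((k , j) ∷ E) , canonical , abut)
... | inj₂ (L , j∸1<L , L≤top , L∉) =
  ⊥-elim (missing-letter⇒¬SameCycle π _ L rep L∉ bottom top
            (subst (_< L) (sym (toℕ-fromℕ< _)) j∸1<L) (subst (L ≤_) (sym (toℕ-fromℕ< _)) L≤top)
            (cs bottom top bottom-moved top-moved))
  where
  g : ℕ → ℕ
  g = evalℕ (wordOf ((k , j) ∷ E))
  bottom<n : j ∸ 1 < n
  bottom<n = <-trans (j∸1<k 1≤j j≤k) k<n
  top<n : lastTop k E < n
  top<n = lastTop<n n k j E oks
  bottom top : Fin n
  bottom = fromℕ< bottom<n
  top    = fromℕ< top<n
  toℕ-π : ∀ {m} (m<n : m < n) → toℕ (π ⟨$⟩ʳ fromℕ< m<n) ≡ g m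
  toℕ-π m<n = trans (represents⇒models _ π rep (fromℕ< m<n)) (cong g (toℕ-fromℕ< m<n))
  bottom-moved : π ⟨$⟩ʳ bottom ≢ bottom
  bottom-moved e = <⇒≢ (j∸1<k 1≤j j≤k)
    (trans (sym (toℕ-fromℕ< _)) (trans (cong toℕ (sym e)) (trans (toℕ-π bottom<n) (bottom-rises n k j E oks inc u))))
  top-moved : π ⟨$⟩ʳ top ≢ top
  top-moved e = <⇒≢ (lastTop-falls n k j E oks inc)
    (trans (sym (toℕ-π top<n)) (trans (cong toℕ e) (toℕ-fromℕ< _)))

-- A unimodal cycle is represented by a canonical chain expression

UnimodalOn-unique : ∀ {f h a b ascends} → UnimodalOn f a b ascends → UnimodalOn h a b ascends → ∀ x → f x ≡ h x
UnimodalOn-unique {f} {h} {a} {b} {ascends} U V x = by-position (a ≤? x) (x ≤? b)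
  where
  module U = UnimodalOn U
  module V = UnimodalOn V
  outside : x < a ⊎ b < x → f x ≡ h x
  outside out = trans (U.fixes-outside x out) (sym (V.fixes-outside x out))
  on-descent : OnDescent a b ascends x → f x ≡ h x
  on-descent d with <-cmp (f x) (h x)
  ... | tri≈ _ fx≡hx _ = fx≡hx
  ... | tri< fx<hx _ _ = ⊥-elim (U.descent-nearest x d (h x) fx<hx (V.descent-falls x d) (V.descent-lands x d))
  ... | tri> _ _ hx<fx = ⊥-elim (V.descent-nearest x d (f x) hx<fx (U.descent-falls x d) (U.descent-lands x d))
  on-ascent : OnAscent a b ascends x → f x ≡ h x
  on-ascent h′ with <-cmp (f x) (h x)
  ... | tri≈ _ fx≡hx _ = fx≡hx
  ... | tri< fx<hx _ _ = ⊥-elim (V.ascent-nearest x h′ (f x) (U.ascent-rises x h′) fx<hx (U.ascent-lands x h′))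
  ... | tri> _ _ hx<fx = ⊥-elim (U.ascent-nearest x h′ (h x) (V.ascent-rises x h′) hx<fx (V.ascent-lands x h′))
  by-position : Dec (a ≤ x) → Dec (x ≤ b) → f x ≡ h x
  by-position (no a≰x)  _         = outside (inj₁ (≰⇒> a≰x))
  by-position (yes _)   (no x≰b)  = outside (inj₂ (≰⇒> x≰b))
  by-position (yes a≤x) (yes x≤b) = [ on-descent , on-ascent ]′ (Dynamics.descent⊎ascent U x a≤x x≤b)

ascendsOf-below : ∀ k E x → x < k → ascendsOf k E x ≡ false
ascendsOf-below k []             x _   = refl
ascendsOf-below k ((k′ , _) ∷ E) x x<k = ascendsFrom-below k (ascendsOf k′ E) x x<k

record ChainFor (n a d : ℕ) (ascends : ℕ → Bool) : Set where
  field
    k         : ℕ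
    rest      : Expr
    blocks-ok : All (BlockOK n) ((k , suc a) ∷ rest)
    abutting  : Linked Abutting ((k , suc a) ∷ rest)
    lastTop≡  : lastTop k rest ≡ a + suc d
    ascends≡  : ∀ x → a < x → x < a + suc d → ascendsOf k rest x ≡ ascends x

-- a+1 is an ascent point iff a new block starts there
buildChain : ∀ n a d ascends → a + suc d < n → ChainFor n a d ascends
buildChain n a zero ascends a+1<n = record
  { k = suc a ; rest = [] ; blocks-ok = (s≤s z≤n , ≤-refl , subst (_< n) (+-comm a 1) a+1<n) ∷ []
  ; abutting = [-] ; lastTop≡ = +-comm 1 a
  ; ascends≡ = λ x a<x x<a+1 → ⊥-elim (<-irrefl refl (<-≤-trans a<x (s≤s⁻¹ (subst (x <_) (+-comm a 1) x<a+1)))) }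
buildChain n a (suc d) ascends a+d+2<n = by-value (ascends (suc a)) refl
  where
  shift : suc a + suc d ≡ a + suc (suc d)
  shift = sym (+-suc a (suc d))
  module R = ChainFor (buildChain n (suc a) d ascends (subst (_< n) (sym shift) a+d+2<n))
  by-value : ∀ v → ascends (suc a) ≡ v → ChainFor n a (suc d) ascends
  by-value true a+1-ascends = record
    { k = suc a ; rest = (R.k , suc (suc a)) ∷ R.rest
    ; blocks-ok = (s≤s z≤n , ≤-refl , ≤-<-trans (s≤s (m≤m+n a (suc d))) (subst (_< n) (sym shift) a+d+2<n)) ∷ R.blocks-ok
    ; abutting = refl ∷ R.abutting
    ; lastTop≡ = trans R.lastTop≡ shift
    ; ascends≡ = agree }
    where
    agree : ∀ x → a < x → x < a + suc (suc d) → ascendsFrom (suc a) (ascendsOf R.k R.rest) x ≡ ascends x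
    agree x a<x x< with <-cmp x (suc a)
    ... | tri< x<a+1 _ _ = ⊥-elim (<-irrefl refl (<-≤-trans a<x (s≤s⁻¹ x<a+1)))
    ... | tri≈ _ refl _ = trans (ascendsFrom-start (suc a) _) (sym a+1-ascends)
    ... | tri> _ _ a+1<x = trans (ascendsFrom-above (suc a) _ x a+1<x) (R.ascends≡ x a+1<x (subst (x <_) (sym shift) x<))
  by-value false a+1-descends = record
    { k = R.k ; rest = R.rest
    ; blocks-ok = (s≤s z≤n , <⇒≤ a+2≤k , k<n) ∷ All.tail R.blocks-ok
    ; abutting = relink R.abutting
    ; lastTop≡ = trans R.lastTop≡ shift
    ; ascends≡ = agree }
    where
    a+2≤k : suc (suc a) ≤ R.k
    a+2≤k = proj₁ (proj₂ (All.head R.blocks-ok))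
    k<n : R.k < n
    k<n = proj₂ (proj₂ (All.head R.blocks-ok))
    relink : ∀ {E} → Linked Abutting ((R.k , suc (suc a)) ∷ E) → Linked Abutting ((R.k , suc a) ∷ E)
    relink [-]       = [-]
    relink (r ∷ rs) = r ∷ rs
    agree : ∀ x → a < x → x < a + suc (suc d) → ascendsOf R.k R.rest x ≡ ascends x
    agree x a<x x< with <-cmp x (suc a)
    ... | tri< x<a+1 _ _ = ⊥-elim (<-irrefl refl (<-≤-trans a<x (s≤s⁻¹ x<a+1)))
    ... | tri≈ _ refl _ = trans (ascendsOf-below R.k R.rest (suc a) a+2≤k) (sym a+1-descends)
    ... | tri> _ _ a+1<x = R.ascends≡ x a+1<x (subst (x <_) (sym shift) x<)

covering⇒length≥ : ∀ a d (w : List ℕ) → (∀ ℓ → a < ℓ → ℓ ≤ a + d → ℓ ∈ w) → d ≤ length w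
covering⇒length≥ a zero    w _     = z≤n
covering⇒length≥ a (suc d) w cover
  with ∈-∃++ (cover (a + suc d) (subst (a <_) (sym (+-suc a d)) (s≤s (m≤m+n a d))) ≤-refl)
... | w₁ , w₂ , refl = subst (suc d ≤_) (sym length-w) (s≤s (covering⇒length≥ a d (w₁ ++ w₂) cover′))
  where
  length-w : length (w₁ ++ (a + suc d) ∷ w₂) ≡ suc (length (w₁ ++ w₂))
  length-w = trans (length-++ w₁) (trans (+-suc (length w₁) (length w₂)) (cong suc (sym (length-++ w₁))))
  cover′ : ∀ ℓ → a < ℓ → ℓ ≤ a + d → ℓ ∈ w₁ ++ w₂
  cover′ ℓ a<ℓ ℓ≤a+d with ∈-++⁻ w₁ (cover ℓ a<ℓ (≤-trans ℓ≤a+d (≤-trans (n≤1+n (a + d)) (≤-reflexive (sym (+-suc a d))))))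
  ... | inj₁ ℓ∈w₁         = ∈-++⁺ˡ ℓ∈w₁
  ... | inj₂ (here ℓ≡)    = ⊥-elim (<-irrefl (trans ℓ≡ (+-suc a d)) (s≤s ℓ≤a+d))
  ... | inj₂ (there ℓ∈w₂) = ∈-++⁺ʳ w₁ ℓ∈w₂

module FromUnimodal {n} (π : Perm n) {g : ℕ → ℕ} (model : Models π g)
                    {a b : ℕ} {ascends : ℕ → Bool} (U : UnimodalOn g a b ascends) (b<n : b < n) where
  private
    d : ℕ
    d = b ∸ suc a
    a+1+d≡b : a + suc d ≡ b
    a+1+d≡b = trans (+-suc a d) (m+[n∸m]≡n (UnimodalOn.a<b U))

  open ChainFor (buildChain n a d ascends (subst (_< n) (sym a+1+d≡b) b<n))

  E : Expr
  E = (k , suc a) ∷ rest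

  chain-unimodal′ : UnimodalOn (evalℕ (wordOf E)) a b ascends
  chain-unimodal′ =
    UnimodalOn-ascends-cong.UnimodalOn-ascends (λ x a<x x<b → ascends≡ x a<x (subst (x <_) (sym a+1+d≡b) x<b))
      (subst (λ top → UnimodalOn (evalℕ (wordOf E)) a top (ascendsOf k rest)) (trans lastTop≡ a+1+d≡b)
             (chain-unimodal n k (suc a) rest blocks-ok abutting))

  represents : Represents n (wordOf E) π
  represents =
    wordOf-valid n E blocks-ok ,
    λ x → toℕ-injective (trans (toℕ-evalW n _ x (wordOf-valid n E blocks-ok))
                               (trans (UnimodalOn-unique chain-unimodal′ U (toℕ x)) (sym (model x))))

  length-E : length (wordOf E) + a ≡ b
  length-E = trans (chain-length n k (suc a) rest blocks-ok abutting) (trans lastTop≡ a+1+d≡b)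

  -- a word without the letter ℓ ∈ (a,b] cannot carry a (below ℓ) into the cycle of b
  shortest : ∀ w → Represents n w π → length (wordOf E) ≤ length w
  shortest w rep = +-cancelʳ-≤ a (length (wordOf E)) (length w)
    (subst (_≤ length w + a) (sym length-E)
           (subst (_≤ length w + a) (trans (+-comm (suc d) a) a+1+d≡b) (+-monoˡ-≤ a (covering⇒length≥ a (suc d) w cover))))
    where
    open OnPerm π model U b<n using (top; in-segment⇒reaches-top)
    bottom : Fin n
    bottom = fromℕ< (<-trans (UnimodalOn.a<b U) b<n)
    cover : ∀ ℓ → a < ℓ → ℓ ≤ a + suc d → ℓ ∈ w
    cover ℓ a<ℓ ℓ≤ with ℓ ∈? w
    ... | yes ℓ∈w = ℓ∈w
    ... | no ℓ∉w  = ⊥-elim (missing-letter⇒¬SameCycle π w ℓ rep (All.map (λ ℓ≢ e → ℓ≢ (sym e)) (Allₚ.¬Any⇒All¬ w ℓ∉w))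
                      bottom top (subst (_< ℓ) (sym (toℕ-fromℕ< _)) a<ℓ)
                      (subst (ℓ ≤_) (trans a+1+d≡b (sym (toℕ-fromℕ< b<n))) ℓ≤)
                      (in-segment⇒reaches-top bottom (≤-reflexive (sym (toℕ-fromℕ< _)))
                                              (subst (_≤ b) (sym (toℕ-fromℕ< _)) (<⇒≤ (UnimodalOn.a<b U)))))

  condIII : CondIII n π
  condIII = inj₂ (E , ((blocks-ok , abutting⇒increasing abutting (All.map (proj₁ ∘ proj₂) blocks-ok)) ,
                       represents , shortest) , abutting)

module UnimodalOrbit (f : ℕ → ℕ) (b s m : ℕ)
  (0<m : 0 < m) (m<s : m < s)
  (period    : iterℕ f s b ≡ b)
  (below-top : ∀ t → 0 < t → t < s → iterℕ f t b < b)
  (falling   : ∀ t → t < m → iterℕ f (suc t) b < iterℕ f t b)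
  (rising    : ∀ t → m ≤ t → suc t < s → iterℕ f t b < iterℕ f (suc t) b)
  (covers    : ∀ z → iterℕ f m b ≤ z → z ≤ b → ∃ λ t → t < s × iterℕ f t b ≡ z)
  (moved     : ∀ z → f z ≢ z → ∃ λ t → t < s × iterℕ f t b ≡ z) where

  K : ℕ → ℕ
  K t = iterℕ f t b

  a : ℕ
  a = K m

  ascends : ℕ → Bool
  ascends z = does (z <? f z)

  ascends⇒< : ∀ {z} → ascends z ≡ true → z < f z
  ascends⇒< {z} = from-does (z <? f z)
    where
    from-does : (z<? : Dec (z < f z)) → does z<? ≡ true → z < f z
    from-does (yes z<fz) _ = z<fz

  ¬ascends⇒≮ : ∀ {z} → ascends z ≡ false → ¬ z < f z
  ¬ascends⇒≮ {z} = from-does (z <? f z)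
    where
    from-does : (z<? : Dec (z < f z)) → does z<? ≡ false → ¬ z < f z
    from-does (no z≮fz) _ = z≮fz

  K≤b : ∀ t → t ≤ s → K t ≤ b
  K≤b zero    _ = ≤-refl
  K≤b (suc t) t<s with suc t ≟ s
  ... | yes refl = ≤-reflexive period
  ... | no t+1≢s = <⇒≤ (below-top (suc t) (s≤s z≤n) (≤∧≢⇒< t<s t+1≢s))

  falling-≤ : ∀ r t → r ≤ t → t ≤ m → K t ≤ K r
  falling-≤ r zero    z≤n _ = ≤-refl
  falling-≤ r (suc t) r≤t+1 t<m with r ≟ suc t
  ... | yes refl = ≤-refl
  ... | no r≢t+1 = ≤-trans (<⇒≤ (falling t t<m)) (falling-≤ r t (s≤s⁻¹ (≤∧≢⇒< r≤t+1 r≢t+1)) (<⇒≤ t<m))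

  falling-< : ∀ r t → r < t → t ≤ m → K t < K r
  falling-< r (suc t) r≤t t<m = <-≤-trans (falling t t<m) (falling-≤ r t (s≤s⁻¹ r≤t) (<⇒≤ t<m))

  rising-≤ : ∀ r t → m ≤ r → r ≤ t → t < s → K r ≤ K t
  rising-≤ r zero    _   z≤n _ = ≤-refl
  rising-≤ r (suc t) m≤r r≤t+1 t+1<s with r ≟ suc t
  ... | yes refl = ≤-refl
  ... | no r≢t+1 =
    ≤-trans (rising-≤ r t m≤r r≤t (<-trans (n<1+n t) t+1<s)) (<⇒≤ (rising t (≤-trans m≤r r≤t) t+1<s))
    where
    r≤t : r ≤ t
    r≤t = s≤s⁻¹ (≤∧≢⇒< r≤t+1 r≢t+1)

  rising-< : ∀ r t → m ≤ r → r < t → t < s → K r < K t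
  rising-< r (suc t) m≤r r≤t t+1<s =
    ≤-<-trans (rising-≤ r t m≤r (s≤s⁻¹ r≤t) (<-trans (n<1+n t) t+1<s))
              (rising t (≤-trans m≤r (s≤s⁻¹ r≤t)) t+1<s)

  a<b : a < b
  a<b = falling-< 0 m 0<m ≤-refl

  a≤K : ∀ t → t < s → a ≤ K t
  a≤K t t<s with t ≤? m
  ... | yes t≤m = falling-≤ t m t≤m ≤-refl
  ... | no t≰m  = rising-≤ m t ≤-refl (<⇒≤ (≰⇒> t≰m)) t<s

  fixed : ∀ z → z < a ⊎ b < z → f z ≡ z
  fixed z out with f z ≟ z
  ... | yes fz≡z = fz≡z
  ... | no fz≢z with moved z fz≢z
  ...   | t , t<s , refl =
    ⊥-elim ([ (λ Kt<a → <⇒≱ Kt<a (a≤K t t<s)) , (λ b<Kt → <⇒≱ b<Kt (K≤b t (<⇒≤ t<s))) ]′ out)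

  step-shape : ∀ t → t < s → (t < m × K (suc t) < K t) ⊎ (m ≤ t × K t < K (suc t))
  step-shape t t<s with t <? m
  ... | yes t<m = inj₁ (t<m , falling t t<m)
  ... | no t≮m with suc t <? s
  ...   | yes t+1<s = inj₂ (≮⇒≥ t≮m , rising t (≮⇒≥ t≮m) t+1<s)
  ...   | no t+1≮s  = inj₂ (m≤t , subst (K t <_) (sym (trans (cong K t+1≡s) period)) (below-top t 0<t t<s))
    where
    m≤t : m ≤ t
    m≤t = ≮⇒≥ t≮m
    0<t : 0 < t
    0<t = <-≤-trans 0<m m≤t
    t+1≡s : suc t ≡ s
    t+1≡s = ≤-antisym t<s (≮⇒≥ t+1≮s)

  rising-or-top : ∀ t → m ≤ t → t < s → K t < K (suc t)
  rising-or-top t m≤t t<s with step-shape t t<s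
  ... | inj₁ (t<m , _) = ⊥-elim (<⇒≱ t<m m≤t)
  ... | inj₂ (_ , Kt<Kt+1) = Kt<Kt+1

  descent-index : ∀ z → OnDescent a b ascends z → ∃ λ t → t < m × K t ≡ z
  descent-index z d with OnDescent-range {ascends = ascends} a<b d
  ... | a<z , z≤b with covers z (<⇒≤ a<z) z≤b
  ...   | t , t<s , Kt≡z with step-shape t t<s | d
  ...     | inj₁ (t<m , _) | _ = t , t<m , Kt≡z
  ...     | inj₂ (m≤t , _) | inj₁ z≡b = ⊥-elim (<⇒≢ (below-top t (<-≤-trans 0<m m≤t) t<s) (trans Kt≡z z≡b))
  ...     | inj₂ (_ , Kt<Kt+1) | inj₂ (_ , _ , z-descends) =
    ⊥-elim (¬ascends⇒≮ z-descends (subst (λ y → y < f y) Kt≡z Kt<Kt+1))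

  ascent-index : ∀ z → OnAscent a b ascends z → ∃ λ t → m ≤ t × t < s × K t ≡ z
  ascent-index z (inj₁ z≡a) = m , ≤-refl , m<s , sym z≡a
  ascent-index z (inj₂ (a<z , z<b , z-ascends)) with covers z (<⇒≤ a<z) (<⇒≤ z<b)
  ... | t , t<s , Kt≡z with step-shape t t<s
  ...   | inj₂ (m≤t , _) = t , m≤t , t<s , Kt≡z
  ...   | inj₁ (_ , Kt+1<Kt) = ⊥-elim (<-asym (ascends⇒< z-ascends) (subst (λ y → f y < y) Kt≡z Kt+1<Kt))

  descent⁺-index : ∀ z → OnDescent⁺ a b ascends z → ∃ λ t → t ≤ m × K t ≡ z
  descent⁺-index z (inj₁ d)    = map₂ (map₁ <⇒≤) (descent-index z d)
  descent⁺-index z (inj₂ z≡a) = m , ≤-refl , sym z≡a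

  on-descent : ∀ t → t < m → OnDescent a b ascends (K t)
  on-descent zero    _     = inj₁ refl
  on-descent (suc t) t+1<m =
    inj₂ (falling-< (suc t) m t+1<m ≤-refl , below-top (suc t) (s≤s z≤n) (<-trans t+1<m m<s) ,
          dec-false (K (suc t) <? f (K (suc t))) (<-asym (falling (suc t) t+1<m)))

  on-descent⁺ : ∀ t → t ≤ m → OnDescent⁺ a b ascends (K t)
  on-descent⁺ t t≤m with t ≟ m
  ... | yes refl = inj₂ refl
  ... | no t≢m   = inj₁ (on-descent t (≤∧≢⇒< t≤m t≢m))

  on-ascent⁺ : ∀ t → m ≤ t → t < s → OnAscent⁺ a b ascends (K (suc t))
  on-ascent⁺ t m≤t t<s with suc t <? s
  ... | no t+1≮s  = inj₂ (trans (cong K (≤-antisym t<s (≮⇒≥ t+1≮s))) period)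
  ... | yes t+1<s = inj₁ (inj₂ (rising-< m (suc t) ≤-refl (s≤s m≤t) t+1<s , below-top (suc t) (s≤s z≤n) t+1<s ,
                                dec-true (K (suc t) <? f (K (suc t))) (rising-or-top (suc t) (m≤n⇒m≤1+n m≤t) t+1<s)))

  unimodal : UnimodalOn f a b ascends
  unimodal = record
    { a<b             = a<b
    ; fixes-outside   = fixed
    ; descent-falls   = λ z d → let (t , t<m , Kt≡z) = descent-index z d in
                          subst (λ y → f y < y) Kt≡z (falling t t<m)
    ; descent-lands   = λ z d → let (t , t<m , Kt≡z) = descent-index z d in
                          subst (λ y → OnDescent⁺ a b ascends (f y)) Kt≡z (on-descent⁺ (suc t) t<m)
    ; descent-nearest = descent-nearest
    ; ascent-rises    = λ z h → let (t , m≤t , t<s , Kt≡z) = ascent-index z h in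
                          subst (λ y → y < f y) Kt≡z (rising-or-top t m≤t t<s)
    ; ascent-lands    = λ z h → let (t , m≤t , t<s , Kt≡z) = ascent-index z h in
                          subst (λ y → OnAscent⁺ a b ascends (f y)) Kt≡z (on-ascent⁺ t m≤t t<s)
    ; ascent-nearest  = ascent-nearest }
    where
    descent-nearest : ∀ z → OnDescent a b ascends z → ∀ y → f z < y → y < z → ¬ OnDescent⁺ a b ascends y
    descent-nearest z d y fz<y y<z d⁺ with descent-index z d | descent⁺-index y d⁺
    ... | t , t<m , refl | r , r≤m , refl with r ≤? t
    ...   | yes r≤t = <⇒≱ y<z (falling-≤ r t r≤t (<⇒≤ t<m))
    ...   | no r≰t  = <⇒≱ fz<y (falling-≤ (suc t) r (≰⇒> r≰t) r≤m)

    ascent-nearest : ∀ z → OnAscent a b ascends z → ∀ y → z < y → y < f z → ¬ OnAscent⁺ a b ascends y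
    ascent-nearest z h y z<y y<fz h⁺ with ascent-index z h
    ascent-nearest z h y z<y y<fz (inj₂ refl) | t , _ , t<s , refl = <⇒≱ y<fz (K≤b (suc t) t<s)
    ascent-nearest z h y z<y y<fz (inj₁ h′) | t , m≤t , t<s , refl with ascent-index y h′
    ... | r , m≤r , r<s , refl with r ≤? t
    ...   | yes r≤t = <⇒≱ z<y (rising-≤ r t m≤r r≤t t<s)
    ...   | no r≰t  = <⇒≱ y<fz (rising-≤ (suc t) r (m≤n⇒m≤1+n m≤t) (≰⇒> r≰t) r<s)

-- (ii) ⇒ (iii)

positions : ∀ {n} → Perm n → ℕ → ℕ
positions {n} π z with z <? n
... | yes z<n = toℕ (π ⟨$⟩ʳ fromℕ< z<n)
... | no _    = z

positions-models : ∀ {n} (π : Perm n) → Models π (positions π)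
positions-models {n} π x with toℕ x <? n
... | yes x<n = cong (λ y → toℕ (π ⟨$⟩ʳ y)) (sym (fromℕ<-toℕ x x<n))
... | no x≮n  = ⊥-elim (x≮n (toℕ<n x))

positions-beyond : ∀ {n} (π : Perm n) z → ¬ z < n → positions π z ≡ z
positions-beyond {n} π z z≮n with z <? n
... | yes z<n = ⊥-elim (z≮n z<n)
... | no _    = refl

iter-injective : ∀ {n} (π : Perm n) m {x y} → iter π m x ≡ iter π m y → x ≡ y
iter-injective π zero    e = e
iter-injective π (suc m) e =
  iter-injective π m (trans (sym (inverseˡ π)) (trans (cong (π ⟨$⟩ˡ_) e) (inverseˡ π)))

iter-comm : ∀ {n} (π : Perm n) m t x → iter π m (iter π t x) ≡ iter π t (iter π m x)
iter-comm π m t x = trans (sym (iter-+ π m t x)) (trans (cong (λ r → iter π r x) (+-comm m t)) (iter-+ π t m x))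

module _ {n} (π : Perm n) {k : Fin n} {s : ℕ} (0<s : 0 < s) (πˢk≡k : iter π s k ≡ k) where

  orbit-reduce : ∀ t → ∃ λ r → r < s × iter π t k ≡ iter π r k
  orbit-reduce zero = 0 , 0<s , refl
  orbit-reduce (suc t) with orbit-reduce t
  ... | r , r<s , πᵗk≡πʳk with suc r <? s
  ...   | yes r+1<s = suc r , r+1<s , cong (π ⟨$⟩ʳ_) πᵗk≡πʳk
  ...   | no r+1≮s  = 0 , 0<s , trans (cong (π ⟨$⟩ʳ_) πᵗk≡πʳk)
                                      (trans (cong (λ m → iter π m k) (≤-antisym r<s (≮⇒≥ r+1≮s))) πˢk≡k)

  -- x₀ = π^{(s−1)·mk} k when k = π^{mk} x₀, so the whole cycle of x₀ lies in the orbit of k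
  same-cycle⇒in-orbit : ∀ {x₀ y} → SameCycle π x₀ k → SameCycle π x₀ y → ∃ λ r → r < s × iter π r k ≡ y
  same-cycle⇒in-orbit {x₀} {y} (mk , πᵐᵏx₀≡k) (m , πᵐx₀≡y) =
    let (r , r<s , e) = orbit-reduce (m + pred s * mk) in r , r<s , trans (sym e) lands-on-y
    where
    πˢx₀≡x₀ : iter π s x₀ ≡ x₀
    πˢx₀≡x₀ = iter-injective π mk
      (trans (iter-comm π mk s x₀) (trans (cong (iter π s) πᵐᵏx₀≡k) (trans πˢk≡k (sym πᵐᵏx₀≡k))))
    multiple-period : ∀ q → iter π (q * s) x₀ ≡ x₀
    multiple-period zero    = refl
    multiple-period (suc q) = trans (iter-+ π s (q * s) x₀) (trans (cong (iter π s) (multiple-period q)) πˢx₀≡x₀)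
    open ≡-Reasoning
    index≡ : m + pred s * mk + mk ≡ m + mk * s
    index≡ = begin
      m + pred s * mk + mk   ≡⟨ +-assoc m _ mk ⟩
      m + (pred s * mk + mk) ≡⟨ cong (m +_) (+-comm (pred s * mk) mk) ⟩
      m + suc (pred s) * mk  ≡⟨ cong (λ r → m + r * mk) (suc-pred s {{>-nonZero 0<s}}) ⟩
      m + s * mk             ≡⟨ cong (m +_) (*-comm s mk) ⟩
      m + mk * s             ∎
    lands-on-y : iter π (m + pred s * mk) k ≡ y
    lands-on-y = begin
      iter π (m + pred s * mk) k                ≡⟨ cong (iter π (m + pred s * mk)) (sym πᵐᵏx₀≡k) ⟩
      iter π (m + pred s * mk) (iter π mk x₀)   ≡⟨ sym (iter-+ π (m + pred s * mk) mk x₀) ⟩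
      iter π (m + pred s * mk + mk) x₀          ≡⟨ cong (λ r → iter π r x₀) index≡ ⟩
      iter π (m + mk * s) x₀                    ≡⟨ iter-+ π m (mk * s) x₀ ⟩
      iter π m (iter π (mk * s) x₀)             ≡⟨ cong (iter π m) (multiple-period mk) ⟩
      iter π m x₀                               ≡⟨ πᵐx₀≡y ⟩
      y                                         ∎

module FromCondII {n} (π : Perm n) (x₀ : Fin n) (x₀-moved : π ⟨$⟩ʳ x₀ ≢ x₀)
  (moved⇒same-cycle : (y : Fin n) → π ⟨$⟩ʳ y ≢ y → SameCycle π x₀ y)
  (c d : ℕ) (segment : (y : Fin n) → SameCycle π x₀ y ⇔ ((c ≤ toℕ y) × (toℕ y ≤ d)))
  (k : Fin n) (s : ℕ) (k-in-cycle : SameCycle π x₀ k)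
  (k-max : (y : Fin n) → SameCycle π x₀ y → toℕ y ≤ toℕ k)
  (0<s : 0 < s) (πˢk≡k : iter π s k ≡ k) (s-least : (t : ℕ) → 0 < t → t < s → iter π t k ≢ k)
  (m : ℕ) (m<s : suc m ≤ s)
  (falling : (t : ℕ) → suc t < suc m → toℕ (iter π (suc t) k) < toℕ (iter π t k))
  (rising : (t : ℕ) → suc m ≤ suc t → suc t < s → toℕ (iter π t k) < toℕ (iter π (suc t) k)) where

  private
    g : ℕ → ℕ
    g = positions π

    model : Models π g
    model = positions-models π

    K : ℕ → ℕ
    K t = iterℕ g t (toℕ k)

    toℕ-iter-k : ∀ t → toℕ (iter π t k) ≡ K t
    toℕ-iter-k t = toℕ-iter model t k

    orbit-in-cycle : ∀ t → SameCycle π x₀ (iter π t k)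
    orbit-in-cycle t = let (mk , e) = k-in-cycle in t + mk , trans (iter-+ π t mk x₀) (cong (iter π t) e)

    K≤b : ∀ t → K t ≤ toℕ k
    K≤b t = subst (_≤ toℕ k) (toℕ-iter-k t) (k-max _ (orbit-in-cycle t))

    below-top : ∀ t → 0 < t → t < s → K t < toℕ k
    below-top t 0<t t<s = ≤∧≢⇒< (K≤b t) (λ e → s-least t 0<t t<s (toℕ-injective (trans (toℕ-iter-k t) e)))

    in-cycle⇒on-orbit : ∀ y → SameCycle π x₀ y → ∃ λ t → t < s × K t ≡ toℕ y
    in-cycle⇒on-orbit y same = let (t , t<s , πᵗk≡y) = same-cycle⇒in-orbit π 0<s πˢk≡k k-in-cycle same
                               in t , t<s , trans (sym (toℕ-iter-k t)) (cong toℕ πᵗk≡y)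

    0<m : 0 < m
    0<m with m ≟ 0 | 1 <? s
    ... | no m≢0  | _        = n≢0⇒n>0 m≢0
    ... | yes m≡0 | yes 1<s  =
      ⊥-elim (<⇒≱ (subst₂ _<_ (toℕ-iter-k 0) (toℕ-iter-k 1) (rising 0 (≤-reflexive (cong suc m≡0)) 1<s)) (K≤b 1))
    ... | yes _   | no 1≮s with in-cycle⇒on-orbit x₀ (0 , refl)
    ...   | suc _ , r+1<s , _ = ⊥-elim (1≮s (≤-trans (s≤s (s≤s z≤n)) r+1<s))
    ...   | zero , _ , k≡x₀ = ⊥-elim (x₀-moved (trans (cong (π ⟨$⟩ʳ_) x₀≡k) (trans πk≡k (sym x₀≡k))))
      where
      x₀≡k : x₀ ≡ k
      x₀≡k = toℕ-injective (sym k≡x₀)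
      πk≡k : iter π 1 k ≡ k
      πk≡k = subst (λ r → iter π r k ≡ k) (≤-antisym (≮⇒≥ 1≮s) 0<s) πˢk≡k

    covers : ∀ z → K m ≤ z → z ≤ toℕ k → ∃ λ t → t < s × K t ≡ z
    covers z a≤z z≤b =
      let (t , t<s , Kt≡y) = in-cycle⇒on-orbit y (Equivalence.from (segment y) (c≤y , y≤d))
      in t , t<s , trans Kt≡y (toℕ-fromℕ< z<n)
      where
      z<n : z < n
      z<n = ≤-<-trans z≤b (toℕ<n k)
      y : Fin n
      y = fromℕ< z<n
      c≤y : c ≤ toℕ y
      c≤y = ≤-trans (subst (c ≤_) (toℕ-iter-k m) (proj₁ (Equivalence.to (segment _) (orbit-in-cycle m))))
                    (subst (_ ≤_) (sym (toℕ-fromℕ< z<n)) a≤z)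
      y≤d : toℕ y ≤ d
      y≤d = ≤-trans (subst (_≤ toℕ k) (sym (toℕ-fromℕ< z<n)) z≤b)
                    (proj₂ (Equivalence.to (segment k) (orbit-in-cycle 0)))

    moved-on-orbit : ∀ z → g z ≢ z → ∃ λ t → t < s × K t ≡ z
    moved-on-orbit z gz≢z = by-bound (z <? n)
      where
      by-bound : Dec (z < n) → ∃ λ t → t < s × K t ≡ z
      by-bound (no z≮n)  = ⊥-elim (gz≢z (positions-beyond π z z≮n))
      by-bound (yes z<n) =
        let (t , t<s , Kt≡y) = in-cycle⇒on-orbit y (moved⇒same-cycle y y-moved)
        in t , t<s , trans Kt≡y (toℕ-fromℕ< z<n)
        where
        y : Fin n
        y = fromℕ< z<n
        y-moved : π ⟨$⟩ʳ y ≢ y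
        y-moved e = gz≢z (trans (cong g (sym (toℕ-fromℕ< z<n)))
                                (trans (sym (model y)) (trans (cong toℕ e) (toℕ-fromℕ< z<n))))

  open UnimodalOrbit g (toℕ k) s m 0<m m<s
    (trans (sym (toℕ-iter-k s)) (cong toℕ πˢk≡k)) below-top
    (λ t t<m → subst₂ _<_ (toℕ-iter-k (suc t)) (toℕ-iter-k t) (falling t (s≤s t<m)))
    (λ t m≤t t+1<s → subst₂ _<_ (toℕ-iter-k t) (toℕ-iter-k (suc t)) (rising t (s≤s m≤t) t+1<s))
    covers moved-on-orbit
    using (unimodal)

  condIII : CondIII n π
  condIII = FromUnimodal.condIII π model unimodal (toℕ<n k)

II⇒III : ∀ n π → CondII n π → CondIII n π
II⇒III n π (inj₁ id) = inj₁ id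
II⇒III n π (inj₂ (x₀ , x₀-moved , moved⇒same , (c , d , segment) ,
                  (k , s , k-in , k-max , (0<s , πˢk≡k , s-least) , suc m , _ , m<s , falling , rising))) =
  FromCondII.condIII π x₀ x₀-moved moved⇒same c d segment k s k-in k-max 0<s πˢk≡k s-least m m<s falling rising
II⇒III n π (inj₂ (_ , _ , _ , _ , (_ , _ , _ , _ , _ , zero , () , _)))

corollary2p6 : (n : ℕ) (π : Perm n) →
    ((bS n π × cS n π) ⇔ CondII n π) × (CondII n π ⇔ CondIII n π)
corollary2p6 n π = mk⇔ (III⇒II n π ∘ I⇒III n π) (III⇒I n π ∘ II⇒III n π)
                 , mk⇔ (II⇒III n π) (III⇒II n π)
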